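{- Let $n\ge 2$ and let $w=Q_{n-1}Q_{n-2}\cdots Q_1\in D_n$ where $Q_m\in\mathcal W_m$ for $1\le m\le n-2$ and $Q_{n-1}\in\mathcal W_{n-1}$. For each $m$ let $L_m$ be the list attached to $Q_m$. Then for every $1\le i\le n-2$, $$(Q_{n-1}Q_{n-2}\cdots Q_{i+1})(L_i)\ \sim_i\ w\nwarrow i,$$ and moreover $L_{n-1}\sim_{n-1} w\nwarrow (n-1)$.
   Context: Order $\pm[n]$ totally by $1<2<\dots<n<-n<\dots<-2<-1$. A signed permutation is a bijection $w$ of $\pm[n]$ with $w(-a)=-w(a)$, written $[w(1),\dots,w(n)]$; it is even if an even number of $w(1),\dots,w(n)$ are negative. $D_n$ is the group of even signed permutations under composition $(uv)(a)=u(v(a))$, generated by $s_i$ ($1\le i\le n-1$) exchanging $i$ and $i+1$, and $s_n$ with $s_n(n-1)=-n$, $s_n(n)=-(n-1)$, $s_n(a)=a$ for $a\le n-2$. For a signed permutation $u$ and a list $L=[l_1,\dots,l_k]$ of elements of $\pm[n]$, $u(L):=[u(l_1),\dots,u(l_k)]$. For $1\le m\le n-2$, $\mathcal W_m$ consists of: $\mathrm{id}$ (with attached list $L_m=[\,]$); $s_ms_{m+1}\cdots s_j$ for $m\le j\le n-1$ (list $[m+1,\dots,j+1]$); $s_m\cdots s_{n-2}s_ns_{n-1}s_{n-2}\cdots s_j$ for $m\le j\le n-1$, where for $j=n-1$ this means $s_m\cdots s_{n-2}s_ns_{n-1}$ (list $[m+1,\dots,n,-n,-(n-1),\dots,-(j+1)]$);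 and $s_m\cdots s_{n-2}s_n$ (list $[m+1,\dots,n-1,-n]$). $\mathcal W_{n-1}=\{\mathrm{id},s_{n-1},s_ns_{n-1},s_n\}$ with attached lists $[\,]$, $[n]$, $[n,-n]$, $[-n]$ respectively. The unfolding of a signed permutation $u$ is the sequence $u(1),\dots,u(n),-u(n),\dots,-u(1)$. For $t\in\pm[n]$ and an ordered list $L$ of distinct elements of $\pm[n]$, $h_{t,L}(u)$ is computed by: among elements of $L$ greater than $t$ appearing to the right of the entry $t$ in the unfolding of $u$, take the one $q$ occurring latest in $L$; if none, stop; otherwise exchange the entries $t$ and $q$ and the entries $-t$ and $-q$ in the unfolding (if $q=-t$, just exchange $t$ and $-t$), and repeat. For lists $L,L'$, write $L\sim_i L'$ if $h_{i,L}(u)=h_{i,L'}(u)$ for all $u\in D_n$. For $w\in D_n$ and $i\in[n]$, $w\nwarrow i$ is the list of entries $x$ of the unfolding of $w$ lying strictly left of the entry $i$ with $i<x<-i$, in order of appearance. -}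

module Defs where

open import Data.Bool using (Bool; true; false; if_then_else_; _∧_; _∨_; not)
open import Data.Nat as ℕ using (ℕ; zero; suc; _∸_; _≡ᵇ_; _<ᵇ_)
open import Data.Integer as ℤ using (ℤ; +_; -_; ∣_∣)
open import Data.Fin using (Fin; toℕ)
open import Data.List using (List; []; _∷_; _++_; map; reverse; upTo; allFin; last; filterᵇ; takeWhileᵇ; length)
open import Data.Maybe using (Maybe; just; nothing)
open import Data.Product using (Σ; _×_)
open import Function using (id; _∘_)
open import Relation.Nullary using (does)
open import Relation.Binary.PropositionalEquality using (_≡_)

-- Elements of ±[n] are represented as (nonzero) integers.

infix 4 _==_
_==_ : ℤ → ℤ → Bool
x == y = does (x ℤ.≟ y)

neg : ℕ → ℤ
neg k = - (+ k)

isPos : ℤ → Bool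
isPos x = does (+ 0 ℤ.<? x)

-- The total order 1 < 2 < ... < n < -n < ... < -2 < -1 on ±[n]
-- (on positives and on negatives it agrees with the order of ℤ,
--  and every positive is below every negative).
infix 4 _<±_
_<±_ : ℤ → ℤ → Bool
x <± y = (isPos x ∧ not (isPos y))
       ∨ ((isPos x ∧ isPos y) ∨ (not (isPos x) ∧ not (isPos y))) ∧ does (x ℤ.<? y)

-- [a, a+1, ..., b]  (empty if b < a)
range : ℕ → ℕ → List ℕ
range a b = map (a ℕ.+_) (upTo (suc b ∸ a))

sSwap : ℕ → ℤ → ℤ
sSwap k x =
  if x == + k then + (suc k) else
  if x == + (suc k) then + k else
  if x == neg k then neg (suc k) else
  if x == neg (suc k) then neg k else x

sLast : ℕ → ℤ → ℤ
sLast n x =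
  if x == + (n ∸ 1) then neg n else
  if x == + n then neg (n ∸ 1) else
  if x == neg (n ∸ 1) then + n else
  if x == neg n then + (n ∸ 1) else x

gen : ℕ → ℕ → ℤ → ℤ
gen n k = if k ≡ᵇ n then sLast n else sSwap k

-- the word s_{a₁} s_{a₂} ⋯ s_{aₖ}, as a map: x ↦ s_{a₁}(s_{a₂}(⋯ s_{aₖ}(x)))
-- (composition (uv)(a) = u(v(a)))
word : ℕ → List ℕ → ℤ → ℤ
word n []       = id
word n (a ∷ as) = gen n a ∘ word n as

-- The sets 𝒲_m (1 ≤ m ≤ n-2), elements indexed by their description.

data Wc (n m : ℕ) : Set where
  idW  : Wc n m
  upW  : (j : ℕ) → m ℕ.≤ j → j ℕ.≤ n ∸ 1 → Wc n m
  dnW  : (j : ℕ) → m ℕ.≤ j → j ℕ.≤ n ∸ 1 → Wc n m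
  tipW : Wc n m

wordW : (n m : ℕ) → Wc n m → List ℕ
wordW n m idW         = []
wordW n m (upW j _ _) = range m j
wordW n m (dnW j _ _) = range m (n ∸ 2) ++ (n ∷ reverse (range j (n ∸ 1)))
wordW n m tipW        = range m (n ∸ 2) ++ (n ∷ [])

actW : (n m : ℕ) → Wc n m → ℤ → ℤ
actW n m q = word n (wordW n m q)

listW : (n m : ℕ) → Wc n m → List ℤ
listW n m idW         = []
listW n m (upW j _ _) = map +_ (range (suc m) (suc j))
listW n m (dnW j _ _) = map +_ (range (suc m) n) ++ map (neg) (reverse (range (suc j) n))
listW n m tipW        = map +_ (range (suc m) (n ∸ 1)) ++ (neg n ∷ [])

data WLast : Set where
  idL s₁L s₂₁L s₂L : WLast

wordL : ℕ → WLast → List ℕ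
wordL n idL  = []
wordL n s₁L  = (n ∸ 1) ∷ []
wordL n s₂₁L = n ∷ (n ∸ 1) ∷ []
wordL n s₂L  = n ∷ []

actL : ℕ → WLast → ℤ → ℤ
actL n q = word n (wordL n q)

listL : ℕ → WLast → List ℤ
listL n idL  = []
listL n s₁L  = + n ∷ []
listL n s₂₁L = + n ∷ neg n ∷ []
listL n s₂L  = neg n ∷ []

-- Q_{m+c-1} ∘ ⋯ ∘ Q_{m+1} ∘ Q_m
compFrom : (n : ℕ) → ((m : ℕ) → Wc n m) → (m c : ℕ) → ℤ → ℤ
compFrom n Q m zero    = id
compFrom n Q m (suc c) = compFrom n Q (suc m) c ∘ actW n m (Q m)

prodFrom : (n : ℕ) → ((m : ℕ) → Wc n m) → WLast → ℕ → ℤ → ℤ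
prodFrom n Q QL k = actL n QL ∘ compFrom n Q k (n ∸ 1 ∸ k)

-- Even signed permutations D_n, in one-line notation [w(1), …, w(n)]
-- (index i : Fin n stands for i+1).

record Dn (n : ℕ) : Set where
  field
    val    : Fin n → ℤ
    bound  : ∀ i → 1 ℕ.≤ ∣ val i ∣ × ∣ val i ∣ ℕ.≤ n
    inj    : ∀ i j → ∣ val i ∣ ≡ ∣ val j ∣ → i ≡ j
    even   : Σ ℕ λ k → length (filterᵇ (not ∘ isPos ∘ val) (allFin n)) ≡ 2 ℕ.* k

unfoldD : {n : ℕ} → Dn n → List ℤ
unfoldD {n} u = map (Dn.val u) (allFin n) ++ reverse (map (λ i → - Dn.val u i) (allFin n))

posList : ℕ → List ℤ
posList n = map +_ (range 1 n)

unfoldF : ℕ → (ℤ → ℤ) → List ℤ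
unfoldF n f = map f (posList n) ++ reverse (map (λ x → - f x) (posList n))

index : ℤ → List ℤ → Maybe ℕ
index x []       = nothing
index x (y ∷ ys) = if x == y then just 0 else Data.Maybe.map suc (index x ys)
  where import Data.Maybe

rightOf : List ℤ → ℤ → ℤ → Bool
rightOf U t x with index t U | index x U
... | just a | just b = a <ᵇ b
... | _      | _      = false

candidate : ℤ → List ℤ → List ℤ → Maybe ℤ
candidate t L U = last (filterᵇ (λ x → (t <± x) ∧ rightOf U t x) L)

-- exchange entries t,q and -t,-q in U (if q = -t this just exchanges t and -t)
exch : ℤ → ℤ → List ℤ → List ℤ
exch t q = map λ e →
  if e == t then q else
  if e == q then t else
  if e == - t then - q else
  if e == - q then - t else e

-- the iteration, with fuel.  Each step moves t strictly to the right in the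
-- unfolding (length 2n), so 2n steps of fuel always suffice.
hLoop : ℕ → ℤ → List ℤ → List ℤ → List ℤ
hLoop zero    t L U = U
hLoop (suc k) t L U with candidate t L U
... | nothing = U
... | just q  = hLoop k t L (exch t q U)

-- h_{t,L}(u), returned as its unfolding (which determines it)
h : (n : ℕ) → ℤ → List ℤ → Dn n → List ℤ
h n t L u = hLoop (2 ℕ.* n) t L (unfoldD u)

Sim : (n i : ℕ) → List ℤ → List ℤ → Set
Sim n i L L' = (u : Dn n) → h n (+ i) L u ≡ h n (+ i) L' u

nwarrow : ℕ → (ℤ → ℤ) → ℕ → List ℤ
nwarrow n w i =
  filterᵇ (λ x → (+ i <± x) ∧ (x <± neg i))
          (takeWhileᵇ (λ x → not (x == + i)) (unfoldF n w))

-- Write w = P ∘ Q_i ∘ R with R = Q_{i-1} ⋯ Q_1 and P = Q_{n-1} ⋯ Q_{i+1}.  Every Q_m is odd and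
-- fixes ±1, …, ±(m-1).  Hence the entries of absolute value ≥ i of R(1), …, R(n) are i, …, n in
-- this order, except that the last one may be -n; and entries of absolute value < i neither end
-- nor enter w ↖ i.  So w ↖ i is P applied to the entries of the unfolding of Q_i(i), …, Q_i(n) that
-- precede i and have absolute value > i (P fixes ±i), and the explicit action of the four kinds of
-- elements of 𝒲_i on i, …, n shows that these form L_i.  A wrong sign of n only exchanges an
-- adjacent pair n, -n, and h_{i,L} does not see such exchanges in L: they matter only when both
-- entries are eligible and nothing later in L is, and then h exchanges i with a and with -a in
-- either order; the symmetry of unfoldings keeps the second exchange available, and the two
-- exchanges commute.

module Submission where

open import Defs
open import Data.Bool using (Bool; true; false; if_then_else_; _∧_; not; T)
open import Data.Bool.Properties using (∧-zeroʳ; ∧-identityʳ; T-≡)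
open import Data.Empty using (⊥-elim)
open import Data.Integer as ℤ using (ℤ; +_; -_; ∣_∣; -[1+_])
open import Data.Integer.Properties using (neg-involutive; neg-injective; ∣-i∣≡∣i∣; +-injective)
open import Data.List
  using (List; []; _∷_; _++_; _∷ʳ_; map; reverse; length; filterᵇ; takeWhileᵇ; last; allFin; upTo; applyUpTo;
         InitLast; initLast; _∷ʳ′_)
open import Data.List.Properties
  using (map-∘; map-++; map-cong; map-id; map-upTo; length-map; length-++; length-reverse; length-tabulate;
         ++-assoc; ++-identityʳ; unfold-reverse; reverse-++; reverse-map; filter-++; filter-all; filter-≐)
open import Data.List.Relation.Unary.All as All using (All; []; _∷_)
import Data.List.Relation.Unary.All.Properties as All
open import Data.List.Relation.Unary.AllPairs as AllPairs using (AllPairs; []; _∷_)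
import Data.List.Relation.Unary.AllPairs.Properties as AllPairs
open import Data.List.Relation.Unary.Unique.Propositional.Properties using (allFin⁺)
open import Data.Maybe as Maybe using (just; nothing)
import Data.Maybe.Properties as Maybe
open import Data.Nat as ℕ using (ℕ; zero; suc; _+_; _∸_; _≤_; _<_; z≤n; s≤s; _<ᵇ_; _≤ᵇ_; _≡ᵇ_)
import Data.Nat.Properties as ℕₚ
open import Data.Nat.Tactic.RingSolver using (solve-∀)
open import Data.Product using (∃-syntax; _×_; _,_; proj₁; proj₂)
open import Data.Sum using (_⊎_; inj₁; inj₂)
open import Function using (id; _∘_; case_of_)
open import Function.Bundles using (Equivalence)
open import Relation.Nullary using (¬_; Dec; yes; no)
open import Relation.Nullary.Decidable using (dec-true; dec-false; T?)
open import Relation.Binary.PropositionalEquality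
open ≡-Reasoning

==-refl : ∀ x → (x == x) ≡ true
==-refl x = dec-true (x ℤ.≟ x) refl

==-≢ : ∀ {x y} → x ≢ y → (x == y) ≡ false
==-≢ {x} {y} = dec-false (x ℤ.≟ y)

-≢self : ∀ {x} → x ≢ + 0 → - x ≢ x
-≢self {+ zero}   x≢0 _ = x≢0 refl
-≢self {+ suc _}  _ ()
-≢self { -[1+ _ ]} _ ()

-≢0 : ∀ {x} → x ≢ + 0 → - x ≢ + 0
-≢0 {x} x≢0 -x≡0 = x≢0 (neg-injective -x≡0)

-≢- : ∀ {x y} → x ≢ y → - x ≢ - y
-≢- x≢y = x≢y ∘ neg-injective

neg-move : ∀ {x y} → - x ≡ y → x ≡ - y
neg-move {x} refl = sym (neg-involutive x)

∧-true : ∀ {a b} → (a ∧ b) ≡ true → a ≡ true × b ≡ true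
∧-true {true} {true} _ = refl , refl

<ᵇ-true : ∀ {p q} → p < q → (p <ᵇ q) ≡ true
<ᵇ-true p<q = Equivalence.to T-≡ (ℕₚ.<⇒<ᵇ p<q)

<ᵇ-false : ∀ {p q} → q ≤ p → (p <ᵇ q) ≡ false
<ᵇ-false {p} {q} q≤p with p <ᵇ q in p<ᵇq
... | false = refl
... | true  = ⊥-elim (ℕₚ.<-irrefl refl (ℕₚ.<-≤-trans (ℕₚ.<ᵇ⇒< p q (Equivalence.from T-≡ p<ᵇq)) q≤p))

<ᵇ-false⁻¹ : ∀ {p q} → (p <ᵇ q) ≡ false → q ≤ p
<ᵇ-false⁻¹ p≮q = ℕₚ.≮⇒≥ (λ p<q → case trans (sym (<ᵇ-true p<q)) p≮q of λ ())

All-reverse : ∀ {A : Set} {P : A → Set} {xs} → All P xs → All P (reverse xs)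
All-reverse {xs = []}     []         = []
All-reverse {xs = x ∷ xs} (px ∷ pxs) rewrite unfold-reverse x xs = All.∷ʳ⁺ (All-reverse pxs) px

last-++-∷ : ∀ (xs : List ℤ) y ys → last (xs ++ y ∷ ys) ≡ last (y ∷ ys)
last-++-∷ []            y ys = refl
last-++-∷ (x ∷ [])      y ys = refl
last-++-∷ (x ∷ x' ∷ xs) y ys = last-++-∷ (x' ∷ xs) y ys

filterᵇ-accept : ∀ (p : ℤ → Bool) {x} xs → p x ≡ true → filterᵇ p (x ∷ xs) ≡ x ∷ filterᵇ p xs
filterᵇ-accept p xs px rewrite px = refl

filterᵇ-reject : ∀ (p : ℤ → Bool) {x} xs → p x ≡ false → filterᵇ p (x ∷ xs) ≡ filterᵇ p xs
filterᵇ-reject p xs px rewrite px = refl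

filterᵇ-swap : ∀ (p : ℤ → Bool) {x y} Y → p x ≡ false → filterᵇ p (x ∷ y ∷ Y) ≡ filterᵇ p (y ∷ x ∷ Y)
filterᵇ-swap p {x} {y} Y px = by-value (p y) refl
  where
    by-value : ∀ b → p y ≡ b → filterᵇ p (x ∷ y ∷ Y) ≡ filterᵇ p (y ∷ x ∷ Y)
    by-value true  py = begin
      filterᵇ p (x ∷ y ∷ Y)   ≡⟨ filterᵇ-reject p _ px ⟩
      filterᵇ p (y ∷ Y)       ≡⟨ filterᵇ-accept p Y py ⟩
      y ∷ filterᵇ p Y         ≡⟨ cong (y ∷_) (filterᵇ-reject p Y px) ⟨
      y ∷ filterᵇ p (x ∷ Y)   ≡⟨ filterᵇ-accept p _ py ⟨
      filterᵇ p (y ∷ x ∷ Y)   ∎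
    by-value false py = begin
      filterᵇ p (x ∷ y ∷ Y)   ≡⟨ filterᵇ-reject p _ px ⟩
      filterᵇ p (y ∷ Y)       ≡⟨ filterᵇ-reject p Y py ⟩
      filterᵇ p Y             ≡⟨ filterᵇ-reject p Y px ⟨
      filterᵇ p (x ∷ Y)       ≡⟨ filterᵇ-reject p _ py ⟨
      filterᵇ p (y ∷ x ∷ Y)   ∎

last-filterᵇ : ∀ (p : ℤ → Bool) L {q} → last (filterᵇ p L) ≡ just q → p q ≡ true
last-filterᵇ p (x ∷ L) eq with p x in px
... | false = last-filterᵇ p L eq
... | true with filterᵇ p L in L'
...   | []     with refl ← eq = px
...   | _ ∷ _  = last-filterᵇ p L (trans (cong last L') eq)

filterᵇ-[]-mono : ∀ {p q : ℤ → Bool} → (∀ y → p y ≡ false → q y ≡ false) →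
                  ∀ Y → filterᵇ p Y ≡ [] → filterᵇ q Y ≡ []
filterᵇ-[]-mono                 p⇒q []      _  = refl
filterᵇ-[]-mono {p} {q} p⇒q (y ∷ Y) eq with p y in py
... | false rewrite p⇒q y py = filterᵇ-[]-mono p⇒q Y eq

filterᵇ-all : ∀ {p : ℤ → Bool} {xs} → All (λ x → p x ≡ true) xs → filterᵇ p xs ≡ xs
filterᵇ-all {p} all = filter-all (T? ∘ p) (All.map (Equivalence.from T-≡) all)

filterᵇ-absorb : ∀ {p q : ℤ → Bool} → (∀ x → p x ≡ true → q x ≡ true) →
                 ∀ xs → filterᵇ p (filterᵇ q xs) ≡ filterᵇ p xs
filterᵇ-absorb         p⇒q []       = refl
filterᵇ-absorb {p} {q} p⇒q (x ∷ xs) with q x in qx | p x in px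
... | true  | true  = trans (filterᵇ-accept p _ px) (cong (x ∷_) (filterᵇ-absorb p⇒q xs))
... | true  | false = trans (filterᵇ-reject p _ px) (filterᵇ-absorb p⇒q xs)
... | false | true  with () ← trans (sym (p⇒q x px)) qx
... | false | false = filterᵇ-absorb p⇒q xs

filterᵇ-map : ∀ {p : ℤ → Bool} {f : ℤ → ℤ} → (∀ x → p (f x) ≡ p x) →
              ∀ xs → filterᵇ p (map f xs) ≡ map f (filterᵇ p xs)
filterᵇ-map         p∘f≗p []       = refl
filterᵇ-map {p} {f} p∘f≗p (x ∷ xs) with p x in px
... | true  = trans (filterᵇ-accept p _ (trans (p∘f≗p x) px)) (cong (f x ∷_) (filterᵇ-map p∘f≗p xs))
... | false = trans (filterᵇ-reject p _ (trans (p∘f≗p x) px)) (filterᵇ-map p∘f≗p xs)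

filterᵇ-reverse : ∀ (p : ℤ → Bool) xs → filterᵇ p (reverse xs) ≡ reverse (filterᵇ p xs)
filterᵇ-reverse p []       = refl
filterᵇ-reverse p (x ∷ xs) = begin
  filterᵇ p (reverse (x ∷ xs))                ≡⟨ cong (filterᵇ p) (unfold-reverse x xs) ⟩
  filterᵇ p (reverse xs ++ x ∷ [])            ≡⟨ filter-++ (T? ∘ p) (reverse xs) (x ∷ []) ⟩
  filterᵇ p (reverse xs) ++ filterᵇ p (x ∷ [])
    ≡⟨ cong (_++ filterᵇ p (x ∷ [])) (filterᵇ-reverse p xs) ⟩
  reverse (filterᵇ p xs) ++ filterᵇ p (x ∷ [])  ≡⟨ last-step (p x) refl ⟩
  reverse (filterᵇ p (x ∷ xs))                ∎
  where
    last-step : ∀ b → p x ≡ b → reverse (filterᵇ p xs) ++ filterᵇ p (x ∷ []) ≡ reverse (filterᵇ p (x ∷ xs))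
    last-step true  px rewrite px = sym (unfold-reverse x (filterᵇ p xs))
    last-step false px rewrite px = ++-identityʳ _

takeWhileᵇ-map : ∀ {q : ℤ → Bool} {f : ℤ → ℤ} → (∀ x → q (f x) ≡ q x) →
                 ∀ xs → takeWhileᵇ q (map f xs) ≡ map f (takeWhileᵇ q xs)
takeWhileᵇ-map         q∘f≗q []       = refl
takeWhileᵇ-map {q} {f} q∘f≗q (x ∷ xs) with q x in qx
... | true  rewrite q∘f≗q x | qx = cong (f x ∷_) (takeWhileᵇ-map q∘f≗q xs)
... | false rewrite q∘f≗q x | qx = refl

-- exch t q = map (exchange t q); the generators sSwap k and sLast n are exchanges as well.
exchange : ℤ → ℤ → ℤ → ℤ
exchange t q e =
  if e == t then q else
  if e == q then t else
  if e == - t then - q else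
  if e == - q then - t else e

module Exchange {t q : ℤ} (t≢0 : t ≢ + 0) (q≢0 : q ≢ + 0) (q≢t : q ≢ t) where

  σ : ℤ → ℤ
  σ = exchange t q

  σ-t : σ t ≡ q
  σ-t rewrite ==-refl t = refl

  σ-q : σ q ≡ t
  σ-q rewrite ==-≢ q≢t | ==-refl q = refl

  σ-neg-t : σ (- t) ≡ - q
  σ-neg-t rewrite ==-≢ (-≢self t≢0) with (- t) ℤ.≟ q
  ... | yes -t≡q = trans (sym (neg-involutive t)) (cong -_ -t≡q)
  ... | no _ rewrite ==-refl (- t) = refl

  σ-neg-q : σ (- q) ≡ - t
  σ-neg-q with (- q) ℤ.≟ t
  ... | yes -q≡t = trans (sym (neg-involutive q)) (cong -_ -q≡t)
  ... | no _ rewrite ==-≢ (-≢self q≢0) | ==-≢ (-≢- q≢t) | ==-refl (- q) = refl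

  σ-other : ∀ {e} → e ≢ t → e ≢ q → e ≢ - t → e ≢ - q → σ e ≡ e
  σ-other e≢t e≢q e≢-t e≢-q rewrite ==-≢ e≢t | ==-≢ e≢q | ==-≢ e≢-t | ==-≢ e≢-q = refl

  data View (e : ℤ) : Set where
    is-t     : e ≡ t → View e
    is-q     : e ≡ q → View e
    is-neg-t : e ≡ - t → View e
    is-neg-q : e ≡ - q → View e
    other    : e ≢ t → e ≢ q → e ≢ - t → e ≢ - q → View e

  view : ∀ e → View e
  view e with e ℤ.≟ t | e ℤ.≟ q | e ℤ.≟ - t | e ℤ.≟ - q
  ... | yes p | _     | _     | _     = is-t p
  ... | no _  | yes p | _     | _     = is-q p
  ... | no _  | no _  | yes p | _     = is-neg-t p
  ... | no _  | no _  | no _  | yes p = is-neg-q p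
  ... | no a  | no b  | no c  | no d  = other a b c d

  involutive : ∀ e → σ (σ e) ≡ e
  involutive e with view e
  ... | is-t refl     rewrite σ-t     = σ-q
  ... | is-q refl     rewrite σ-q     = σ-t
  ... | is-neg-t refl rewrite σ-neg-t = σ-neg-q
  ... | is-neg-q refl rewrite σ-neg-q = σ-neg-t
  ... | other a b c d rewrite σ-other a b c d = σ-other a b c d

  odd : ∀ e → σ (- e) ≡ - σ e
  odd e with view e
  ... | is-t refl     rewrite σ-t = σ-neg-t
  ... | is-q refl     rewrite σ-q = σ-neg-q
  ... | is-neg-t refl rewrite σ-neg-t | neg-involutive t | σ-t = sym (neg-involutive q)
  ... | is-neg-q refl rewrite σ-neg-q | neg-involutive q | σ-q = sym (neg-involutive t)
  ... | other a b c d rewrite σ-other a b c d =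
    σ-other (c ∘ neg-move) (d ∘ neg-move) (a ∘ neg-injective) (b ∘ neg-injective)

  fixes-0 : σ (+ 0) ≡ + 0
  fixes-0 = σ-other (t≢0 ∘ sym) (q≢0 ∘ sym) (-≢0 t≢0 ∘ sym) (-≢0 q≢0 ∘ sym)

module _ {t a : ℤ} (t≢0 : t ≢ + 0) (a≢0 : a ≢ + 0) (a≢t : a ≢ t) (-a≢t : - a ≢ t) where
  private
    module A  = Exchange t≢0 a≢0 a≢t
    module A⁻ = Exchange t≢0 (-≢0 a≢0) -a≢t

    A⁻-a : exchange t (- a) a ≡ - t
    A⁻-a = subst (λ z → exchange t (- a) z ≡ - t) (neg-involutive a) A⁻.σ-neg-q

    A⁻-neg-t : exchange t (- a) (- t) ≡ a
    A⁻-neg-t = trans A⁻.σ-neg-t (neg-involutive a)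

  exchange-comm : ∀ e → exchange t a (exchange t (- a) e) ≡ exchange t (- a) (exchange t a e)
  exchange-comm e with A.view e
  ... | A.is-t refl     rewrite A⁻.σ-t | A.σ-t | A.σ-neg-q | A⁻-a = refl
  ... | A.is-q refl     rewrite A⁻-a | A.σ-q | A.σ-neg-t | A⁻.σ-t = refl
  ... | A.is-neg-t refl rewrite A⁻-neg-t | A.σ-neg-t | A.σ-q | A⁻.σ-q = refl
  ... | A.is-neg-q refl rewrite A⁻.σ-q | A.σ-t | A.σ-neg-q | A⁻-neg-t = refl
  ... | A.other e≢t e≢a e≢-t e≢-a
    rewrite A.σ-other e≢t e≢a e≢-t e≢-a
          | A⁻.σ-other e≢t e≢-a e≢-t (λ e≡--a → e≢a (trans e≡--a (neg-involutive a)))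
          | A.σ-other e≢t e≢a e≢-t e≢-a = refl

==-involution : ∀ {σ : ℤ → ℤ} → (∀ e → σ (σ e) ≡ e) → ∀ y e → (y == σ e) ≡ (σ y == e)
==-involution {σ} inv y e with y ℤ.≟ σ e | σ y ℤ.≟ e
... | yes _      | yes _      = refl
... | no _       | no _       = refl
... | yes y≡σe   | no σy≢e    = ⊥-elim (σy≢e (trans (cong σ y≡σe) (inv e)))
... | no y≢σe    | yes σy≡e   = ⊥-elim (y≢σe (trans (sym (inv y)) (cong σ σy≡e)))

index-map-involution : ∀ {σ : ℤ → ℤ} → (∀ e → σ (σ e) ≡ e) →
                       ∀ y U → index y (map σ U) ≡ index (σ y) U
index-map-involution inv y []      = refl
index-map-involution {σ} inv y (e ∷ U)
  rewrite ==-involution {σ} inv y e | index-map-involution {σ} inv y U = refl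

index-++-just : ∀ {e r} M N → index e M ≡ just r → index e (M ++ N) ≡ just r
index-++-just {e} (x ∷ M) N eq with e == x
... | true  = eq
... | false with index e M in eqM
index-++-just {e} (x ∷ M) N refl | false | just r rewrite index-++-just M N eqM = refl

index-++-nothing : ∀ {e} M N → index e M ≡ nothing →
                   index e (M ++ N) ≡ Maybe.map (λ r → length M + r) (index e N)
index-++-nothing {e} []      N _  = sym (Maybe.map-id (index e N))
index-++-nothing {e} (x ∷ M) N eq with e == x
... | false with index e M in eqM
... | nothing rewrite index-++-nothing M N eqM = sym (Maybe.map-∘ (index e N))

index-∉ : ∀ {e} W → All (e ≢_) W → index e W ≡ nothing
index-∉ []      []           = refl
index-∉ (y ∷ W) (e≢y ∷ e∉W) rewrite ==-≢ e≢y | index-∉ W e∉W = refl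

record Symmetric (U : List ℤ) : Set where
  field
    mirror : ∀ {e r} → index e U ≡ just r →
             ∃[ r' ] index (- e) U ≡ just r' × suc (r + r') ≡ length U
    0∉     : index (+ 0) U ≡ nothing

Symmetric-map : ∀ {σ : ℤ → ℤ} → (∀ e → σ (σ e) ≡ e) → (∀ e → σ (- e) ≡ - σ e) → σ (+ 0) ≡ + 0 →
                ∀ {U} → Symmetric U → Symmetric (map σ U)
Symmetric-map {σ} inv odd σ0 {U} S = record
  { mirror = mirror
  ; 0∉     = trans (index-map-involution inv (+ 0) U)
                   (trans (cong (λ z → index z U) σ0) (Symmetric.0∉ S))
  }
  where
    mirror : ∀ {e r} → index e (map σ U) ≡ just r →
             ∃[ r' ] index (- e) (map σ U) ≡ just r' × suc (r + r') ≡ length (map σ U)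
    mirror {e} eq with Symmetric.mirror S (trans (sym (index-map-involution inv e U)) eq)
    ... | r' , at-r' , len =
      r' , trans (index-map-involution inv (- e) U) (trans (cong (λ z → index z U) (odd e)) at-r')
         , trans len (sym (length-map σ U))

Symmetric-exch : ∀ {t q U} → t ≢ + 0 → q ≢ + 0 → q ≢ t → Symmetric U → Symmetric (exch t q U)
Symmetric-exch t≢0 q≢0 q≢t = Symmetric-map E.involutive E.odd E.fixes-0
  where module E = Exchange t≢0 q≢0 q≢t

unfold : List ℤ → List ℤ
unfold V = V ++ reverse (map -_ V)

unfold-∷ : ∀ a V → unfold (a ∷ V) ≡ a ∷ (unfold V ∷ʳ - a)
unfold-∷ a V = cong (a ∷_) (begin
  V ++ reverse (- a ∷ map -_ V)        ≡⟨ cong (V ++_) (unfold-reverse (- a) (map -_ V)) ⟩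
  V ++ (reverse (map -_ V) ∷ʳ - a)     ≡⟨ ++-assoc V (reverse (map -_ V)) (- a ∷ []) ⟨
  unfold V ∷ʳ - a                      ∎)

Symmetric-wrap : ∀ {a M} → a ≢ + 0 → index a M ≡ nothing → index (- a) M ≡ nothing →
                 Symmetric M → Symmetric (a ∷ (M ∷ʳ - a))
Symmetric-wrap {a} {M} a≢0 a∉M -a∉M S = record { mirror = mirror ; 0∉ = 0∉ }
  where
    W : List ℤ
    W = a ∷ (M ∷ʳ - a)

    length-W : length W ≡ suc (length M + 1)
    length-W = cong suc (length-++ M)

    index-W : ∀ {e} → e ≢ a → index e W ≡ Maybe.map suc (index e (M ∷ʳ - a))
    index-W e≢a rewrite ==-≢ e≢a = refl

    a∈W : index a W ≡ just 0
    a∈W rewrite ==-refl a = refl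

    -a∈W : index (- a) W ≡ just (suc (length M + 0))
    -a∈W rewrite ==-≢ (-≢self a≢0) | index-++-nothing M (- a ∷ []) -a∉M | ==-refl (- a) = refl

    ends : ∀ m → suc (suc (m + 0)) ≡ suc (m + 1)
    ends = solve-∀

    mirror-M : ∀ {e r₀} → index e M ≡ just r₀ →
               ∃[ r' ] index (- e) W ≡ just r' × suc (suc r₀ + r') ≡ length W
    mirror-M {e} {r₀} e∈M with Symmetric.mirror S e∈M
    ... | r₀' , -e∈M , len =
      suc r₀' , trans (index-W -e≢a) (cong (Maybe.map suc) (index-++-just M (- a ∷ []) -e∈M)) ,
      trans (arith r₀ r₀' (length M) len) (sym length-W)
      where
        -e≢a : - e ≢ a
        -e≢a -e≡a with () ← trans (sym -e∈M) (subst (λ z → index z M ≡ nothing) (sym -e≡a) a∉M)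
        arith : ∀ x y m → suc (x + y) ≡ m → suc (suc x + suc y) ≡ suc (m + 1)
        arith x y m refl = lemma x y
          where lemma : ∀ x y → suc (suc x + suc y) ≡ suc (suc (x + y) + 1)
                lemma = solve-∀

    mirror : ∀ {e r} → index e W ≡ just r → ∃[ r' ] index (- e) W ≡ just r' × suc (r + r') ≡ length W
    mirror {e} eq with e ℤ.≟ a
    ... | yes refl with refl ← eq =
      suc (length M + 0) , -a∈W , trans (ends (length M)) (sym length-W)
    ... | no e≢a with index e M in e∈M | e ℤ.≟ - a
    ...   | just r₀ | _ rewrite index-++-just M (- a ∷ []) e∈M with refl ← eq = mirror-M e∈M
    ...   | nothing | yes refl rewrite index-++-nothing M (- a ∷ []) e∈M | ==-refl (- a)
                             with refl ← eq =
      0 , subst (λ z → index z W ≡ just 0) (sym (neg-involutive a)) a∈W ,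
      trans (cong suc (ℕₚ.+-identityʳ _)) (trans (ends (length M)) (sym length-W))
    ...   | nothing | no e≢-a rewrite index-++-nothing M (- a ∷ []) e∈M | ==-≢ e≢-a
                             with () ← eq

    0∉ : index (+ 0) W ≡ nothing
    0∉ rewrite ==-≢ (a≢0 ∘ sym) | index-++-nothing M (- a ∷ []) (Symmetric.0∉ S)
             | ==-≢ (-≢0 a≢0 ∘ sym) = refl

index-unfold-∉ : ∀ {e} V → All (λ y → ∣ e ∣ ≢ ∣ y ∣) V → index e (unfold V) ≡ nothing
index-unfold-∉ {e} V e#V = index-∉ (unfold V) (All.++⁺ (All.map (λ ne → ne ∘ cong ∣_∣) e#V)
  (All-reverse (All.map⁺ (All.map (λ {y} ne e≡-y → ne (trans (cong ∣_∣ e≡-y) (∣-i∣≡∣i∣ y))) e#V))))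

Symmetric-unfold : ∀ {V} → All (_≢ + 0) V → AllPairs (λ x y → ∣ x ∣ ≢ ∣ y ∣) V → Symmetric (unfold V)
Symmetric-unfold {[]}    _              _           = record { mirror = λ () ; 0∉ = refl }
Symmetric-unfold {a ∷ V} (a≢0 ∷ V≢0) (a#V ∷ V#) rewrite unfold-∷ a V =
  Symmetric-wrap a≢0 (index-unfold-∉ V a#V)
    (index-unfold-∉ V (All.map (λ ne → ne ∘ trans (sym (∣-i∣≡∣i∣ a))) a#V))
    (Symmetric-unfold V≢0 V#)

unfoldD≡unfold : ∀ {n} (u : Dn n) → unfoldD u ≡ unfold (map (Dn.val u) (allFin n))
unfoldD≡unfold {n} u = cong (λ z → map (Dn.val u) (allFin n) ++ reverse z) (map-∘ (allFin n))

Symmetric-unfoldD : ∀ {n} (u : Dn n) → Symmetric (unfoldD u)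
Symmetric-unfoldD {n} u = subst Symmetric (sym (unfoldD≡unfold u))
  (Symmetric-unfold (All.map⁺ (All.tabulate⁺ val≢0))
    (AllPairs.map⁺ (AllPairs.map (λ {i} {j} i≢j → i≢j ∘ Dn.inj u i j) (allFin⁺ n))))
  where
    val≢0 : ∀ i → Dn.val u i ≢ + 0
    val≢0 i val≡0 with () ← subst (λ z → 1 ≤ ∣ z ∣) val≡0 (proj₁ (Dn.bound u i))

length-unfoldD : ∀ {n} (u : Dn n) → length (unfoldD u) ≡ 2 ℕ.* n
length-unfoldD {n} u = begin
  length (unfoldD u)                                   ≡⟨ length-++ (map (Dn.val u) (allFin n)) ⟩
  length (map (Dn.val u) (allFin n)) + length (reverse (map (λ i → - Dn.val u i) (allFin n)))
    ≡⟨ cong₂ _+_ (length-map _ (allFin n))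
                 (trans (length-reverse (map (λ i → - Dn.val u i) (allFin n))) (length-map _ (allFin n))) ⟩
  length (allFin n) + length (allFin n)                ≡⟨ cong (λ m → m + m) (length-tabulate {n = n} id) ⟩
  n + n                                                ≡⟨ cong (λ m → n + m) (ℕₚ.+-identityʳ n) ⟨
  2 ℕ.* n                                              ∎

-- Exchanging adjacent entries a, -a of L

rightOf-just : ∀ U t x {p q} → index t U ≡ just p → index x U ≡ just q → rightOf U t x ≡ (p <ᵇ q)
rightOf-just U t x t-at x-at rewrite t-at | x-at = refl

rightOf-nothing : ∀ U t x → index x U ≡ nothing → rightOf U t x ≡ false
rightOf-nothing U t x x∉U with index t U
... | nothing = refl
... | just _ rewrite x∉U = refl

≤-advance : ∀ {len k p q} → p < q → len ≤ suc k + suc p → len ≤ k + suc q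
≤-advance {k = k} {p} p<q len≤ =
  ℕₚ.≤-trans len≤ (ℕₚ.≤-trans (ℕₚ.≤-reflexive (sym (ℕₚ.+-suc k (suc p)))) (ℕₚ.+-monoʳ-≤ k (s≤s p<q)))

two-ahead : ∀ {len p pb pnb} → p < pb → p < pnb → suc (pb + pnb) ≡ len → suc (suc p) + suc p ≤ len
two-ahead p<pb p<pnb refl = s≤s (ℕₚ.+-mono-≤ p<pb p<pnb)

fuel-after-two : ∀ {len k p pt} → suc (suc p) + suc p ≤ len → suc (p + pt) ≡ len →
                 len ≤ suc (suc k) + suc p → len ≤ k + suc pt
fuel-after-two {k = k} {p} {pt} long refl len≤ =
  ℕₚ.≤-trans (s≤s (ℕₚ.+-monoˡ-≤ pt p≤k)) (ℕₚ.≤-reflexive (sym (ℕₚ.+-suc k pt)))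
  where
    p≤k : p ≤ k
    p≤k = ℕₚ.≤-pred (ℕₚ.≤-pred (ℕₚ.+-cancelʳ-≤ (suc p) _ _ (ℕₚ.≤-trans long len≤)))

module Loop (i : ℕ) where

  t : ℤ
  t = + suc i

  t≢0 : t ≢ + 0
  t≢0 ()

  eligible : List ℤ → ℤ → Bool
  eligible U x = (t <± x) ∧ rightOf U t x

  -- hLoop runs on fuel; k steps suffice when at most k entries lie right of t, because every
  -- exchange moves t strictly to the right.
  Fuel : ℕ → List ℤ → Set
  Fuel k U = ∀ {p} → index t U ≡ just p → length U ≤ k + suc p

  hLoop-just : ∀ {k L U q} → candidate t L U ≡ just q → hLoop (suc k) t L U ≡ hLoop k t L (exch t q U)
  hLoop-just eq rewrite eq = refl

  hLoop-nothing : ∀ {k L U} → candidate t L U ≡ nothing → hLoop (suc k) t L U ≡ U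
  hLoop-nothing eq rewrite eq = refl

  record Ahead (U : List ℤ) (q : ℤ) : Set where
    field
      pos-t pos-q : ℕ
      t-at  : index t U ≡ just pos-t
      q-at  : index q U ≡ just pos-q
      t<q   : pos-t < pos-q

  ahead : ∀ {U q} → eligible U q ≡ true → Ahead U q
  ahead {U} {q} elig with index t U in t-at | index q U in q-at | proj₂ (∧-true {t <± q} elig)
  ... | just p | just pq | p<ᵇpq = record
    { t-at = t-at ; q-at = q-at ; t<q = ℕₚ.<ᵇ⇒< p pq (Equivalence.from T-≡ p<ᵇpq) }

  module _ {U q} (A : Ahead U q) where
    open Ahead A

    ahead-≢t : q ≢ t
    ahead-≢t refl = ℕₚ.<-irrefl (Maybe.just-injective (trans (sym t-at) q-at)) t<q

    ahead-≢0 : Symmetric U → q ≢ + 0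
    ahead-≢0 S refl with () ← trans (sym (Symmetric.0∉ S)) q-at

  t-after-exch : ∀ {q} → q ≢ + 0 → q ≢ t → ∀ U → index t (exch t q U) ≡ index q U
  t-after-exch q≢0 q≢t U =
    trans (index-map-involution E.involutive t U) (cong (λ z → index z U) E.σ-t)
    where module E = Exchange t≢0 q≢0 q≢t

  step : ∀ {k L U q} → Symmetric U → Fuel (suc k) U → candidate t L U ≡ just q →
         Symmetric (exch t q U) × Fuel k (exch t q U)
  step {k} {L} {U} {q} S F cand = Symmetric-exch t≢0 q≢0 q≢t S , F'
    where
      A : Ahead U q
      A = ahead {U} {q} (last-filterᵇ (eligible U) L cand)
      open Ahead A
      q≢0 : q ≢ + 0
      q≢0 = ahead-≢0 A S
      q≢t : q ≢ t
      q≢t = ahead-≢t A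
      F' : Fuel k (exch t q U)
      F' t-at' = subst₂ _≤_ (sym (length-map (exchange t q) U))
        (cong (λ z → k + suc z) (Maybe.just-injective (trans (sym q-at) (trans (sym (t-after-exch q≢0 q≢t U)) t-at'))))
        (≤-advance t<q (F t-at))

  last-filterᵇ-++ : ∀ (p : ℤ → Bool) X Z {z zs} → filterᵇ p Z ≡ z ∷ zs →
                    last (filterᵇ p (X ++ Z)) ≡ last (z ∷ zs)
  last-filterᵇ-++ p X Z {z} {zs} eq = begin
    last (filterᵇ p (X ++ Z))             ≡⟨ cong last (filter-++ (T? ∘ p) X Z) ⟩
    last (filterᵇ p X ++ filterᵇ p Z)     ≡⟨ cong (λ W → last (filterᵇ p X ++ W)) eq ⟩
    last (filterᵇ p X ++ z ∷ zs)          ≡⟨ last-++-∷ (filterᵇ p X) z zs ⟩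
    last (z ∷ zs)                         ∎

  -- If b and -b are both eligible and nothing after them in L is, h exchanges t with -b and then
  -- with b.  The mirror symmetry puts -t to the right of both; after the first exchange b sits
  -- where -t was, hence is still to the right of t, while -b sits where t was.
  module DoubleStep (X Y : List ℤ) (b : ℤ) {U : List ℤ} (S : Symmetric U)
                    (b-elig : eligible U b ≡ true) (-b-elig : eligible U (- b) ≡ true)
                    (Y-inelig : filterᵇ (eligible U) Y ≡ []) where
    private
      module B  = Ahead (ahead {U} {b} b-elig)
      module B⁻ = Ahead (ahead {U} { - b} -b-elig)

    p pb pnb : ℕ
    p   = B.pos-t
    pb  = B.pos-q
    pnb = B⁻.pos-q

    t-at : index t U ≡ just p
    t-at = B.t-at

    p<pb : p < pb
    p<pb = B.t<q

    p<pnb : p < pnb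
    p<pnb = subst (_< pnb) (Maybe.just-injective (trans (sym B⁻.t-at) B.t-at)) B⁻.t<q

    b-mirror : suc (pb + pnb) ≡ length U
    b-mirror with Symmetric.mirror S B.q-at
    ... | r' , -b-at , len = subst (λ r → suc (pb + r) ≡ length U) (Maybe.just-injective (trans (sym -b-at) B⁻.q-at)) len

    pt : ℕ
    pt = proj₁ (Symmetric.mirror S t-at)

    -t-at : index (- t) U ≡ just pt
    -t-at = proj₁ (proj₂ (Symmetric.mirror S t-at))

    t-mirror : suc (p + pt) ≡ length U
    t-mirror = proj₂ (proj₂ (Symmetric.mirror S t-at))

    pnb<pt : pnb < pt
    pnb<pt = ℕₚ.≰⇒> λ pt≤pnb → ℕₚ.<-irrefl (ℕₚ.suc-injective (trans t-mirror (sym b-mirror)))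
                                          (ℕₚ.+-mono-<-≤ p<pb pt≤pnb)

    p<pt : p < pt
    p<pt = ℕₚ.<-trans p<pnb pnb<pt

    -b≢0 : - b ≢ + 0
    -b≢0 = ahead-≢0 (ahead {U} { - b} -b-elig) S

    -b≢t : - b ≢ t
    -b≢t = ahead-≢t (ahead {U} { - b} -b-elig)

    private
      module E = Exchange t≢0 -b≢0 -b≢t

    U₁ : List ℤ
    U₁ = exch t (- b) U

    index-U₁ : ∀ y → index y U₁ ≡ index (exchange t (- b) y) U
    index-U₁ y = index-map-involution E.involutive y U

    t-at₁ : index t U₁ ≡ just pnb
    t-at₁ = trans (index-U₁ t) (trans (cong (λ z → index z U) E.σ-t) B⁻.q-at)

    b-at₁ : index b U₁ ≡ just pt
    b-at₁ = trans (index-U₁ b)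
      (trans (cong (λ z → index z U) (subst (λ z → exchange t (- b) z ≡ - t) (neg-involutive b) E.σ-neg-q)) -t-at)

    -b-at₁ : index (- b) U₁ ≡ just p
    -b-at₁ = trans (index-U₁ (- b)) (trans (cong (λ z → index z U) E.σ-q) t-at)

    b-elig₁ : eligible U₁ b ≡ true
    b-elig₁ = cong₂ _∧_ (proj₁ (∧-true {t <± b} b-elig))
                        (trans (rightOf-just U₁ t b t-at₁ b-at₁) (<ᵇ-true pnb<pt))

    -b-inelig₁ : eligible U₁ (- b) ≡ false
    -b-inelig₁ = trans (cong ((t <± - b) ∧_) (trans (rightOf-just U₁ t (- b) t-at₁ -b-at₁)
                                                     (<ᵇ-false (ℕₚ.<⇒≤ p<pnb))))
                       (∧-zeroʳ (t <± - b))

    inelig₁ : ∀ y → eligible U y ≡ false → eligible U₁ y ≡ false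
    inelig₁ y inelig with E.view y
    ... | E.is-t refl =
      trans (cong ((t <± t) ∧_) (trans (rightOf-just U₁ t t t-at₁ t-at₁) (<ᵇ-false {pnb} ℕₚ.≤-refl))) (∧-zeroʳ (t <± t))
    ... | E.is-q refl = -b-inelig₁
    ... | E.is-neg-t refl with () ← trans (sym inelig) (trans (rightOf-just U t (- t) t-at -t-at) (<ᵇ-true p<pt))
    ... | E.is-neg-q refl with () ← trans (sym inelig) (subst (λ z → eligible U z ≡ true) (sym (neg-involutive b)) b-elig)
    ... | E.other y≢t y≢-b y≢-t y≢--b = unmoved-inelig y
            (trans (index-U₁ y) (cong (λ z → index z U) (E.σ-other y≢t y≢-b y≢-t y≢--b))) inelig
      where
        unmoved-inelig : ∀ y → index y U₁ ≡ index y U → eligible U y ≡ false → eligible U₁ y ≡ false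
        unmoved-inelig y same inelig with t <± y
        ... | false = refl
        ... | true = unmoved (index y U) refl
          where
            unmoved : ∀ m → index y U ≡ m → rightOf U₁ t y ≡ false
            unmoved nothing   y-at = rightOf-nothing U₁ t y (trans same y-at)
            unmoved (just py) y-at = trans (rightOf-just U₁ t y t-at₁ (trans same y-at))
                                           (<ᵇ-false (ℕₚ.≤-trans py≤p (ℕₚ.<⇒≤ p<pnb)))
              where
                py≤p : py ≤ p
                py≤p = <ᵇ-false⁻¹ (trans (sym (rightOf-just U t y t-at y-at)) inelig)

    L : List ℤ
    L = X ++ b ∷ - b ∷ Y

    first : candidate t L U ≡ just (- b)
    first = last-filterᵇ-++ (eligible U) X (b ∷ - b ∷ Y)
      (trans (filterᵇ-accept (eligible U) (- b ∷ Y) b-elig)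
        (cong (b ∷_) (trans (filterᵇ-accept (eligible U) Y -b-elig) (cong (- b ∷_) Y-inelig))))

    second : candidate t L U₁ ≡ just b
    second = last-filterᵇ-++ (eligible U₁) X (b ∷ - b ∷ Y)
      (trans (filterᵇ-accept (eligible U₁) (- b ∷ Y) b-elig₁)
        (cong (b ∷_) (trans (filterᵇ-reject (eligible U₁) Y -b-inelig₁)
                            (filterᵇ-[]-mono inelig₁ Y Y-inelig))))

  module _ (X Y : List ℤ) (a : ℤ) where
    private
      L₁ L₂ : List ℤ
      L₁ = X ++ a ∷ - a ∷ Y
      L₂ = X ++ - a ∷ a ∷ Y

      middle-agree : ∀ (p : ℤ → Bool) → p a ≡ false ⊎ p (- a) ≡ false →
                     filterᵇ p (a ∷ - a ∷ Y) ≡ filterᵇ p (- a ∷ a ∷ Y)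
      middle-agree p (inj₁ pa)  = filterᵇ-swap p Y pa
      middle-agree p (inj₂ p-a) = sym (filterᵇ-swap p Y p-a)

      agree : ∀ {U} → filterᵇ (eligible U) (a ∷ - a ∷ Y) ≡ filterᵇ (eligible U) (- a ∷ a ∷ Y) →
              candidate t L₁ U ≡ candidate t L₂ U
      agree {U} middle = begin
        last (filterᵇ (eligible U) (X ++ a ∷ - a ∷ Y))
          ≡⟨ cong last (filter-++ (T? ∘ eligible U) X (a ∷ - a ∷ Y)) ⟩
        last (filterᵇ (eligible U) X ++ filterᵇ (eligible U) (a ∷ - a ∷ Y))
          ≡⟨ cong (λ W → last (filterᵇ (eligible U) X ++ W)) middle ⟩
        last (filterᵇ (eligible U) X ++ filterᵇ (eligible U) (- a ∷ a ∷ Y))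
          ≡⟨ cong last (filter-++ (T? ∘ eligible U) X (- a ∷ a ∷ Y)) ⟨
        last (filterᵇ (eligible U) (X ++ - a ∷ a ∷ Y)) ∎

    candidates-agree : ∀ U → candidate t L₁ U ≡ candidate t L₂ U
                           ⊎ eligible U a ≡ true × eligible U (- a) ≡ true × filterᵇ (eligible U) Y ≡ []
    candidates-agree U with eligible U a in ea | eligible U (- a) in e-a
    ... | false | _     = inj₁ (agree {U} (middle-agree (eligible U) (inj₁ ea)))
    ... | true  | false = inj₁ (agree {U} (middle-agree (eligible U) (inj₂ e-a)))
    ... | true  | true with filterᵇ (eligible U) Y in eY
    ...   | []     = inj₂ (refl , refl , refl)
    ...   | y ∷ ys = inj₁ (trans (last-filterᵇ-++ (eligible U) X (a ∷ - a ∷ Y) both)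
                                 (sym (last-filterᵇ-++ (eligible U) X (- a ∷ a ∷ Y) both′)))
      where
        both : filterᵇ (eligible U) (a ∷ - a ∷ Y) ≡ a ∷ - a ∷ y ∷ ys
        both = trans (filterᵇ-accept (eligible U) _ ea)
                     (cong (a ∷_) (trans (filterᵇ-accept (eligible U) _ e-a) (cong (- a ∷_) eY)))
        both′ : filterᵇ (eligible U) (- a ∷ a ∷ Y) ≡ - a ∷ a ∷ y ∷ ys
        both′ = trans (filterᵇ-accept (eligible U) _ e-a)
                      (cong (- a ∷_) (trans (filterᵇ-accept (eligible U) _ ea) (cong (a ∷_) eY)))

    Agree : ℕ → Set
    Agree k = ∀ U → Symmetric U → Fuel k U → hLoop k t L₁ U ≡ hLoop k t L₂ U

    single-step : ∀ {k U} → Agree k → Symmetric U → Fuel (suc k) U → candidate t L₁ U ≡ candidate t L₂ U →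
                  hLoop (suc k) t L₁ U ≡ hLoop (suc k) t L₂ U
    single-step {k} {U} agree S F same = by-candidate (candidate t L₁ U) refl
      where
        by-candidate : ∀ c → candidate t L₁ U ≡ c → hLoop (suc k) t L₁ U ≡ hLoop (suc k) t L₂ U
        by-candidate nothing  c₁ = trans (hLoop-nothing {k} {L₁} c₁) (sym (hLoop-nothing {k} {L₂} (trans (sym same) c₁)))
        by-candidate (just q) c₁ with step {k} {L₁} S F c₁
        ... | S′ , F′ = begin
          hLoop (suc k) t L₁ U          ≡⟨ hLoop-just {k} {L₁} c₁ ⟩
          hLoop k t L₁ (exch t q U)     ≡⟨ agree (exch t q U) S′ F′ ⟩
          hLoop k t L₂ (exch t q U)     ≡⟨ hLoop-just {k} {L₂} (trans (sym same) c₁) ⟨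
          hLoop (suc k) t L₂ U          ∎

    module Double {U} (S : Symmetric U) (ea : eligible U a ≡ true) (e-a : eligible U (- a) ≡ true)
                  (eY : filterᵇ (eligible U) Y ≡ []) where
      private
        module D₁ = DoubleStep X Y a S ea e-a eY
        module D₂ = DoubleStep X Y (- a) S e-a (subst (λ z → eligible U z ≡ true) (sym (neg-involutive a)) ea) eY

        L₂-first : candidate t L₂ U ≡ just a
        L₂-first = subst (λ z → candidate t (X ++ - a ∷ z ∷ Y) U ≡ just z) (neg-involutive a) D₂.first

        L₂-second : candidate t L₂ (exch t a U) ≡ just (- a)
        L₂-second = subst (λ z → candidate t (X ++ - a ∷ z ∷ Y) (exch t z U) ≡ just (- a))
                          (neg-involutive a) D₂.second

        a≢0 : a ≢ + 0
        a≢0 = ahead-≢0 (ahead {U} {a} ea) S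

        a≢t : a ≢ t
        a≢t = ahead-≢t (ahead {U} {a} ea)

        U₂ : List ℤ
        U₂ = exch t a D₁.U₁

        U₂-comm : U₂ ≡ exch t (- a) (exch t a U)
        U₂-comm = trans (sym (map-∘ U)) (trans (map-cong (exchange-comm t≢0 a≢0 a≢t D₁.-b≢t) U) (map-∘ U))

        long : suc (suc D₁.p) + suc D₁.p ≤ length U
        long = two-ahead D₁.p<pb D₁.p<pnb D₁.b-mirror

        S₂ : Symmetric U₂
        S₂ = Symmetric-exch t≢0 a≢0 a≢t (Symmetric-exch t≢0 D₁.-b≢0 D₁.-b≢t S)

        F₂ : ∀ {k} → Fuel (suc (suc k)) U → Fuel k U₂
        F₂ {k} F t-at₂ = subst₂ _≤_ (sym (trans (length-map _ D₁.U₁) (length-map _ U)))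
          (cong (λ z → k + suc z)
                (Maybe.just-injective (trans (sym D₁.b-at₁) (trans (sym (t-after-exch a≢0 a≢t D₁.U₁)) t-at₂))))
          (fuel-after-two long D₁.t-mirror (F D₁.t-at))

      short-fuel : ¬ Fuel 1 U
      short-fuel F = ℕₚ.m+1+n≰m (suc (suc D₁.p)) (ℕₚ.≤-trans long (F D₁.t-at))

      double-step : ∀ {k} → Agree k → Fuel (suc (suc k)) U → hLoop (suc (suc k)) t L₁ U ≡ hLoop (suc (suc k)) t L₂ U
      double-step {k} agree F = begin
        hLoop (suc (suc k)) t L₁ U                     ≡⟨ hLoop-just {suc k} {L₁} {U} D₁.first ⟩
        hLoop (suc k) t L₁ D₁.U₁                       ≡⟨ hLoop-just {k} {L₁} {D₁.U₁} D₁.second ⟩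
        hLoop k t L₁ U₂                                ≡⟨ agree U₂ S₂ (F₂ F) ⟩
        hLoop k t L₂ U₂                                ≡⟨ cong (hLoop k t L₂) U₂-comm ⟩
        hLoop k t L₂ (exch t (- a) (exch t a U))       ≡⟨ hLoop-just {k} {L₂} {exch t a U} L₂-second ⟨
        hLoop (suc k) t L₂ (exch t a U)                ≡⟨ hLoop-just {suc k} {L₂} {U} L₂-first ⟨
        hLoop (suc (suc k)) t L₂ U                     ∎

    swap-invariant : ∀ k → Agree k
    swap-invariant zero          U S F = refl
    swap-invariant (suc k)       U S F with candidates-agree U
    ... | inj₁ same = single-step (swap-invariant k) S F same
    swap-invariant (suc zero)    U S F | inj₂ (ea , e-a , eY) = ⊥-elim (Double.short-fuel S ea e-a eY F)
    swap-invariant (suc (suc k)) U S F | inj₂ (ea , e-a , eY) = Double.double-step S ea e-a eY (swap-invariant k) F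

Sim-swap : ∀ n i X a Y → Sim n (suc i) (X ++ a ∷ - a ∷ Y) (X ++ - a ∷ a ∷ Y)
Sim-swap n i X a Y u = Loop.swap-invariant i X Y a (2 ℕ.* n) (unfoldD u) (Symmetric-unfoldD u) enough
  where
    enough : Loop.Fuel i (2 ℕ.* n) (unfoldD u)
    enough {p} _ = subst (_≤ 2 ℕ.* n + suc p) (sym (length-unfoldD u)) (ℕₚ.m≤m+n (2 ℕ.* n) (suc p))

-- Equality up to the last sign, and up to adjacent exchanges

negLast : List ℤ → List ℤ
negLast []          = []
negLast (x ∷ [])    = - x ∷ []
negLast (x ∷ y ∷ r) = x ∷ negLast (y ∷ r)

infix 4 _≈±_ _⇄_

-- The lower factors R produce i, …, n only up to the sign of n.
_≈±_ : List ℤ → List ℤ → Set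
A ≈± B = B ≡ A ⊎ B ≡ negLast A

data _⇄_ : List ℤ → List ℤ → Set where
  ⇄-refl : ∀ {A} → A ⇄ A
  ⇄-swap : ∀ X a Y → X ++ a ∷ - a ∷ Y ⇄ X ++ - a ∷ a ∷ Y

negLast-involutive : ∀ V → negLast (negLast V) ≡ V
negLast-involutive []              = refl
negLast-involutive (x ∷ [])        = cong (_∷ []) (neg-involutive x)
negLast-involutive (x ∷ y ∷ [])    = cong (λ z → x ∷ z ∷ []) (neg-involutive y)
negLast-involutive (x ∷ y ∷ z ∷ r) = cong (x ∷_) (negLast-involutive (y ∷ z ∷ r))

negLast-flip : ∀ {A B} → A ≡ negLast B → B ≡ negLast A
negLast-flip {B = B} A≡ = trans (sym (negLast-involutive B)) (cong negLast (sym A≡))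

negLast-∷ʳ : ∀ X a → negLast (X ∷ʳ a) ≡ X ∷ʳ - a
negLast-∷ʳ []          a = refl
negLast-∷ʳ (x ∷ [])    a = refl
negLast-∷ʳ (x ∷ y ∷ X) a = cong (x ∷_) (negLast-∷ʳ (y ∷ X) a)

map-negLast : ∀ {f : ℤ → ℤ} → (∀ x → f (- x) ≡ - f x) → ∀ V → map f (negLast V) ≡ negLast (map f V)
map-negLast odd []          = refl
map-negLast odd (x ∷ [])    = cong (_∷ []) (odd x)
map-negLast odd (x ∷ y ∷ r) = cong (_ ∷_) (map-negLast odd (y ∷ r))

≈±-∷ : ∀ x {A B} → A ≈± B → x ∷ A ≈± x ∷ B
≈±-∷ x         (inj₁ refl) = inj₁ refl
≈±-∷ x {[]}    (inj₂ refl) = inj₁ refl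
≈±-∷ x {_ ∷ _} (inj₂ refl) = inj₂ refl

filterᵇ-negLast : ∀ {p : ℤ → Bool} → (∀ x → p (- x) ≡ p x) → ∀ V → filterᵇ p V ≈± filterᵇ p (negLast V)
filterᵇ-negLast {p} p-even []       = inj₁ refl
filterᵇ-negLast {p} p-even (x ∷ []) with p x in px
... | true  = inj₂ (filterᵇ-accept p [] (trans (p-even x) px))
... | false = inj₁ (filterᵇ-reject p [] (trans (p-even x) px))
filterᵇ-negLast {p} p-even (x ∷ y ∷ r) = filterᵇ-∷ (filterᵇ-negLast p-even (y ∷ r))
  where
    filterᵇ-∷ : ∀ {A B} → filterᵇ p A ≈± filterᵇ p B → filterᵇ p (x ∷ A) ≈± filterᵇ p (x ∷ B)
    filterᵇ-∷ A≈B with p x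
    ... | true  = ≈±-∷ x A≈B
    ... | false = A≈B

≈±-trans : ∀ {A B C} → A ≈± B → B ≈± C → A ≈± C
≈±-trans (inj₁ refl) B≈C         = B≈C
≈±-trans (inj₂ refl) (inj₁ refl) = inj₂ refl
≈±-trans {A} (inj₂ refl) (inj₂ refl) = inj₁ (negLast-involutive A)

filterᵇ-≈± : ∀ {p : ℤ → Bool} → (∀ x → p (- x) ≡ p x) → ∀ {A B} → A ≈± B → filterᵇ p A ≈± filterᵇ p B
filterᵇ-≈± p-even     (inj₁ refl) = inj₁ refl
filterᵇ-≈± p-even {A} (inj₂ refl) = filterᵇ-negLast p-even A

map-≈± : ∀ {f : ℤ → ℤ} → (∀ x → f (- x) ≡ - f x) → ∀ {A B} → A ≈± B → map f A ≈± map f B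
map-≈± odd     (inj₁ refl) = inj₁ refl
map-≈± odd {A} (inj₂ refl) = inj₂ (map-negLast odd A)

⇄-resp-≡ : ∀ {A A' B B'} → A ≡ A' → B ≡ B' → A' ⇄ B' → A ⇄ B
⇄-resp-≡ refl refl A⇄B = A⇄B

⇄-∷ : ∀ x {A B} → A ⇄ B → x ∷ A ⇄ x ∷ B
⇄-∷ x ⇄-refl         = ⇄-refl
⇄-∷ x (⇄-swap X a Y) = ⇄-swap (x ∷ X) a Y

map-⇄ : ∀ {f : ℤ → ℤ} → (∀ x → f (- x) ≡ - f x) → ∀ {A B} → A ⇄ B → map f A ⇄ map f B
map-⇄     odd ⇄-refl         = ⇄-refl
map-⇄ {f} odd (⇄-swap X a Y) = subst₂ _⇄_ (sym left) (sym right) (⇄-swap (map f X) (f a) (map f Y))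
  where
    left : map f (X ++ a ∷ - a ∷ Y) ≡ map f X ++ f a ∷ - f a ∷ map f Y
    left = trans (map-++ f X _) (cong (λ z → map f X ++ f a ∷ z ∷ map f Y) (odd a))
    right : map f (X ++ - a ∷ a ∷ Y) ≡ map f X ++ - f a ∷ f a ∷ map f Y
    right = trans (map-++ f X _) (cong (λ z → map f X ++ z ∷ f a ∷ map f Y) (odd a))

⇄⇒Sim : ∀ {n i A B} → A ⇄ B → Sim n (suc i) A B
⇄⇒Sim         ⇄-refl         u = refl
⇄⇒Sim {n} {i} (⇄-swap X a Y)   = Sim-swap n i X a Y

unfold-∷ʳ : ∀ X a → unfold (X ∷ʳ a) ≡ X ++ a ∷ - a ∷ reverse (map -_ X)
unfold-∷ʳ X a = trans (++-assoc X (a ∷ []) _)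
  (cong (λ z → X ++ a ∷ z) (trans (cong reverse (map-++ -_ X (a ∷ []))) (reverse-++ (map -_ X) (- a ∷ []))))

unfold-≈± : ∀ {A B} → A ≈± B → unfold A ⇄ unfold B
unfold-≈± (inj₁ refl) = ⇄-refl
unfold-≈± {A} (inj₂ refl) = by-last (initLast A)
  where
    by-last : ∀ {A} → InitLast A → unfold A ⇄ unfold (negLast A)
    by-last []          = ⇄-refl
    by-last (X ∷ʳ′ a) = subst₂ _⇄_ (sym (unfold-∷ʳ X a))
      (sym (trans (cong unfold (negLast-∷ʳ X a))
                  (trans (unfold-∷ʳ X (- a)) (cong (λ z → X ++ - a ∷ z ∷ reverse (map -_ X)) (neg-involutive a)))))
      (⇄-swap X a (reverse (map -_ X)))

filterᵇ-unfold : ∀ {p : ℤ → Bool} → (∀ x → p (- x) ≡ p x) → ∀ V → filterᵇ p (unfold V) ≡ unfold (filterᵇ p V)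
filterᵇ-unfold {p} p-even V = trans (filter-++ (T? ∘ p) V (reverse (map -_ V)))
  (cong (filterᵇ p V ++_) (trans (filterᵇ-reverse p (map -_ V)) (cong reverse (filterᵇ-map p-even V))))

map-unfold : ∀ {f : ℤ → ℤ} → (∀ x → f (- x) ≡ - f x) → ∀ V → map f (unfold V) ≡ unfold (map f V)
map-unfold {f} odd V = trans (map-++ f V (reverse (map -_ V)))
  (cong (map f V ++_) (trans (reverse-map f (map -_ V))
    (cong reverse (trans (sym (map-∘ V)) (trans (map-cong odd V) (map-∘ V))))))

atLeast : ℕ → ℤ → Bool
atLeast c x = c ≤ᵇ ∣ x ∣

atLeast-even : ∀ c x → atLeast c (- x) ≡ atLeast c x
atLeast-even c x = cong (c ≤ᵇ_) (∣-i∣≡∣i∣ x)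

atLeast-true : ∀ {c} x → c ≤ ∣ x ∣ → atLeast c x ≡ true
atLeast-true {c} x c≤x = Equivalence.to T-≡ (ℕₚ.≤⇒≤ᵇ c≤x)

atLeast-true⁻¹ : ∀ {c} x → atLeast c x ≡ true → c ≤ ∣ x ∣
atLeast-true⁻¹ {c} x big = ℕₚ.≤ᵇ⇒≤ c ∣ x ∣ (Equivalence.from T-≡ big)

atLeast-false : ∀ {c} x → ∣ x ∣ < c → atLeast c x ≡ false
atLeast-false {c} x x<c with atLeast c x in big
... | false = refl
... | true  = ⊥-elim (ℕₚ.<⇒≱ x<c (atLeast-true⁻¹ x big))

atLeast-false⁻¹ : ∀ {c} x → atLeast c x ≡ false → ∣ x ∣ < c
atLeast-false⁻¹ {c} x small = ℕₚ.≰⇒> λ c≤x → case trans (sym (atLeast-true x c≤x)) small of λ ()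

record FixesBelow (c : ℕ) (f : ℤ → ℤ) : Set where
  field
    fixes : ∀ x → ∣ x ∣ < c → f x ≡ x
    keeps : ∀ x → c ≤ ∣ x ∣ → c ≤ ∣ f x ∣
    odd   : ∀ x → f (- x) ≡ - f x

FixesBelow-id : ∀ c → FixesBelow c id
FixesBelow-id c = record { fixes = λ _ _ → refl ; keeps = λ _ c≤x → c≤x ; odd = λ _ → refl }

FixesBelow-∘ : ∀ {c f g} → FixesBelow c f → FixesBelow c g → FixesBelow c (f ∘ g)
FixesBelow-∘ {c} {f} {g} F G = record
  { fixes = λ x x<c → trans (cong f (G.fixes x x<c)) (F.fixes x x<c)
  ; keeps = λ x c≤x → F.keeps (g x) (G.keeps x c≤x)
  ; odd   = λ x → trans (cong f (G.odd x)) (F.odd (g x))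
  }
  where module F = FixesBelow F; module G = FixesBelow G

FixesBelow-weaken : ∀ {c c' f} → c' ≤ c → FixesBelow c f → FixesBelow c' f
FixesBelow-weaken {c} {c'} {f} c'≤c F = record
  { fixes = λ x x<c' → F.fixes x (ℕₚ.<-≤-trans x<c' c'≤c) ; keeps = keeps ; odd = F.odd }
  where
    module F = FixesBelow F
    keeps : ∀ x → c' ≤ ∣ x ∣ → c' ≤ ∣ f x ∣
    keeps x c'≤x with ∣ x ∣ ℕ.<? c
    ... | yes x<c = subst (λ z → c' ≤ ∣ z ∣) (sym (F.fixes x x<c)) c'≤x
    ... | no  x≮c = ℕₚ.≤-trans c'≤c (F.keeps x (ℕₚ.≮⇒≥ x≮c))

FixesBelow-≗ : ∀ {c f g} → (∀ x → f x ≡ g x) → FixesBelow c f → FixesBelow c g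
FixesBelow-≗ {c} {f} {g} f≗g F = record
  { fixes = λ x x<c → trans (sym (f≗g x)) (F.fixes x x<c)
  ; keeps = λ x c≤x → subst (λ z → c ≤ ∣ z ∣) (f≗g x) (F.keeps x c≤x)
  ; odd   = λ x → trans (sym (f≗g (- x))) (trans (F.odd x) (cong -_ (f≗g x)))
  }
  where module F = FixesBelow F

atLeast-invariant : ∀ {c f} → FixesBelow c f → ∀ x → atLeast c (f x) ≡ atLeast c x
atLeast-invariant {c} {f} F x with ∣ x ∣ ℕ.<? c
... | yes x<c = cong (atLeast c) (FixesBelow.fixes F x x<c)
... | no  x≮c = trans (atLeast-true (f x) (FixesBelow.keeps F x (ℕₚ.≮⇒≥ x≮c))) (sym (atLeast-true x (ℕₚ.≮⇒≥ x≮c)))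

==-invariant : ∀ {i f} → FixesBelow (suc i) f → ∀ x → (f x == + i) ≡ (x == + i)
==-invariant {i} {f} F x with ∣ x ∣ ℕ.<? suc i
... | yes x≤i = cong (_== + i) (FixesBelow.fixes F x x≤i)
... | no  x≰i = trans (==-≢ (large (f x) (FixesBelow.keeps F x (ℕₚ.≮⇒≥ x≰i)))) (sym (==-≢ (large x (ℕₚ.≮⇒≥ x≰i))))
  where
    large : ∀ y → suc i ≤ ∣ y ∣ → y ≢ + i
    large y i<y refl = ℕₚ.<-irrefl refl i<y

window : ℕ → List ℤ → List ℤ
window i xs = filterᵇ (atLeast (suc i)) (takeWhileᵇ (λ x → not (x == + i)) xs)

module _ {i : ℕ} where

  window-accept : ∀ {x} xs → x ≢ + i → atLeast (suc i) x ≡ true → window i (x ∷ xs) ≡ x ∷ window i xs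
  window-accept {x} xs x≢i big rewrite ==-≢ x≢i = filterᵇ-accept (atLeast (suc i)) {x} _ big

  window-skip : ∀ {x} xs → x ≢ + i → atLeast (suc i) x ≡ false → window i (x ∷ xs) ≡ window i xs
  window-skip {x} xs x≢i small rewrite ==-≢ x≢i = filterᵇ-reject (atLeast (suc i)) {x} _ small

  window-stop : ∀ {x} xs → x ≡ + i → window i (x ∷ xs) ≡ []
  window-stop xs refl rewrite ==-refl (+ i) = refl

  window-++ : ∀ xs ys → All (_≢ + i) xs → window i (xs ++ ys) ≡ filterᵇ (atLeast (suc i)) xs ++ window i ys
  window-++ []       ys []           = refl
  window-++ (x ∷ xs) ys (x≢i ∷ xs≢i) with atLeast (suc i) x in big
  ... | true  = trans (window-accept {x} _ x≢i big) (cong (x ∷_) (window-++ xs ys xs≢i))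
  ... | false = trans (window-skip {x} _ x≢i big) (window-++ xs ys xs≢i)

  window-pair : ∀ a Y → window i (a ∷ - a ∷ Y) ⇄ window i (- a ∷ a ∷ Y)
  window-pair a Y = by-cases (a ℤ.≟ + i) (- a ℤ.≟ + i)
    where
      -a-level : atLeast (suc i) (- a) ≡ atLeast (suc i) a
      -a-level = atLeast-even (suc i) a

      level-i : a ≡ + i ⊎ - a ≡ + i → ∀ b → ∣ b ∣ ≡ ∣ a ∣ → atLeast (suc i) b ≡ false
      level-i (inj₁ refl)  b |b|≡|a| = atLeast-false b (ℕₚ.≤-reflexive (cong suc |b|≡|a|))
      level-i (inj₂ -a≡i) b |b|≡|a| =
        atLeast-false b (ℕₚ.≤-reflexive (cong suc (trans |b|≡|a| (trans (sym (∣-i∣≡∣i∣ a)) (cong ∣_∣ -a≡i)))))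

      by-cases : Dec (a ≡ + i) → Dec (- a ≡ + i) → window i (a ∷ - a ∷ Y) ⇄ window i (- a ∷ a ∷ Y)
      by-cases (yes a≡i) (yes -a≡i) = ⇄-resp-≡ (window-stop _ a≡i) (window-stop _ -a≡i) ⇄-refl
      by-cases (yes a≡i) (no -a≢i)  = ⇄-resp-≡ (window-stop _ a≡i)
        (trans (window-skip { - a} _ -a≢i (level-i (inj₁ a≡i) (- a) (∣-i∣≡∣i∣ a))) (window-stop _ a≡i)) ⇄-refl
      by-cases (no a≢i)  (yes -a≡i) = ⇄-resp-≡
        (trans (window-skip _ a≢i (level-i (inj₂ -a≡i) a refl)) (window-stop _ -a≡i)) (window-stop _ -a≡i) ⇄-refl
      by-cases (no a≢i)  (no -a≢i)  with atLeast (suc i) a in big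
      ... | true  = ⇄-resp-≡
        (trans (window-accept {a} _ a≢i big) (cong (a ∷_) (window-accept { - a} _ -a≢i (trans -a-level big))))
        (trans (window-accept { - a} _ -a≢i (trans -a-level big)) (cong (- a ∷_) (window-accept {a} _ a≢i big)))
        (⇄-swap [] a (window i Y))
      ... | false = ⇄-resp-≡
        (trans (window-skip {a} _ a≢i big) (window-skip { - a} _ -a≢i (trans -a-level big)))
        (trans (window-skip { - a} _ -a≢i (trans -a-level big)) (window-skip {a} _ a≢i big))
        ⇄-refl

  window-swap : ∀ X a Y → window i (X ++ a ∷ - a ∷ Y) ⇄ window i (X ++ - a ∷ a ∷ Y)
  window-swap []      a Y = window-pair a Y
  window-swap (x ∷ X) a Y = by-cases (x ℤ.≟ + i)
    where
      by-cases : Dec (x ≡ + i) → window i (x ∷ X ++ a ∷ - a ∷ Y) ⇄ window i (x ∷ X ++ - a ∷ a ∷ Y)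
      by-cases (yes x≡i) = ⇄-resp-≡ (window-stop _ x≡i) (window-stop _ x≡i) ⇄-refl
      by-cases (no x≢i) with atLeast (suc i) x in big
      ... | true  = ⇄-resp-≡ (window-accept {x} _ x≢i big) (window-accept {x} _ x≢i big) (⇄-∷ x (window-swap X a Y))
      ... | false = ⇄-resp-≡ (window-skip {x} _ x≢i big) (window-skip {x} _ x≢i big) (window-swap X a Y)

  window-⇄ : ∀ {A B} → A ⇄ B → window i A ⇄ window i B
  window-⇄ ⇄-refl         = ⇄-refl
  window-⇄ (⇄-swap X a Y) = window-swap X a Y

  window-below : ∀ xs → window i xs ≡ window i (filterᵇ (atLeast i) xs)
  window-below []       = refl
  window-below (x ∷ xs) with atLeast i x in level
  ... | false = trans (window-skip {x} xs x≢i (atLeast-false x (ℕₚ.m<n⇒m<1+n |x|<i))) (window-below xs)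
    where
      |x|<i : ∣ x ∣ < i
      |x|<i = atLeast-false⁻¹ x level
      x≢i : x ≢ + i
      x≢i refl = ℕₚ.<-irrefl refl |x|<i
  ... | true = by-cases (x ℤ.≟ + i)
    where
      by-cases : Dec (x ≡ + i) → window i (x ∷ xs) ≡ window i (x ∷ filterᵇ (atLeast i) xs)
      by-cases (yes x≡i) = trans (window-stop xs x≡i) (sym (window-stop _ x≡i))
      by-cases (no x≢i) with atLeast (suc i) x in big
      ... | true  = trans (window-accept xs x≢i big)
                          (trans (cong (x ∷_) (window-below xs)) (sym (window-accept _ x≢i big)))
      ... | false = trans (window-skip xs x≢i big)
                          (trans (window-below xs) (sym (window-skip _ x≢i big)))

window-map : ∀ {i f} → FixesBelow (suc i) f → ∀ xs → window i (map f xs) ≡ map f (window i xs)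
window-map {i} {f} F xs = trans
  (cong (filterᵇ (atLeast (suc i))) (takeWhileᵇ-map (λ x → cong not (==-invariant F x)) xs))
  (filterᵇ-map (atLeast-invariant F) (takeWhileᵇ (λ x → not (x == + i)) xs))

between≡atLeast : ∀ i x → ((+ suc i <± x) ∧ (x <± neg (suc i))) ≡ atLeast (suc (suc i)) x
between≡atLeast i (+ zero)   = refl
between≡atLeast i (+ suc k)  = ∧-identityʳ _
between≡atLeast i -[1+ k ]   = refl

nwarrow≡window : ∀ n w i → nwarrow n w (suc i) ≡ window (suc i) (unfold (map w (posList n)))
nwarrow≡window n w i = trans
  (filter-≐ (λ x → T? ((+ suc i <± x) ∧ (x <± neg (suc i)))) (T? ∘ atLeast (suc (suc i)))
     ((λ {x} → subst T (between≡atLeast i x)) , (λ {x} → subst T (sym (between≡atLeast i x))))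
     (takeWhileᵇ (λ x → not (x == + suc i)) (unfoldF n w)))
  (cong (λ V → window (suc i) (map w (posList n) ++ reverse V)) (map-∘ (posList n)))

exchange-FixesBelow : ∀ {t q} c → t ≢ + 0 → q ≢ + 0 → q ≢ t → c ≤ ∣ t ∣ → c ≤ ∣ q ∣ →
                      FixesBelow c (exchange t q)
exchange-FixesBelow {t} {q} c t≢0 q≢0 q≢t c≤t c≤q = record { fixes = fixes ; keeps = keeps ; odd = E.odd }
  where
    module E = Exchange t≢0 q≢0 q≢t
    c≤-t : c ≤ ∣ - t ∣
    c≤-t = subst (c ≤_) (sym (∣-i∣≡∣i∣ t)) c≤t
    c≤-q : c ≤ ∣ - q ∣
    c≤-q = subst (c ≤_) (sym (∣-i∣≡∣i∣ q)) c≤q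

    fixes : ∀ x → ∣ x ∣ < c → exchange t q x ≡ x
    fixes x x<c with E.view x
    ... | E.is-t refl     = ⊥-elim (ℕₚ.<⇒≱ x<c c≤t)
    ... | E.is-q refl     = ⊥-elim (ℕₚ.<⇒≱ x<c c≤q)
    ... | E.is-neg-t refl = ⊥-elim (ℕₚ.<⇒≱ x<c c≤-t)
    ... | E.is-neg-q refl = ⊥-elim (ℕₚ.<⇒≱ x<c c≤-q)
    ... | E.other x≢t x≢q x≢-t x≢-q = E.σ-other x≢t x≢q x≢-t x≢-q

    keeps : ∀ x → c ≤ ∣ x ∣ → c ≤ ∣ exchange t q x ∣
    keeps x c≤x with E.view x
    ... | E.is-t refl     = subst (λ z → c ≤ ∣ z ∣) (sym E.σ-t) c≤q
    ... | E.is-q refl     = subst (λ z → c ≤ ∣ z ∣) (sym E.σ-q) c≤t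
    ... | E.is-neg-t refl = subst (λ z → c ≤ ∣ z ∣) (sym E.σ-neg-t) c≤-q
    ... | E.is-neg-q refl = subst (λ z → c ≤ ∣ z ∣) (sym E.σ-neg-q) c≤-t
    ... | E.other x≢t x≢q x≢-t x≢-q = subst (λ z → c ≤ ∣ z ∣) (sym (E.σ-other x≢t x≢q x≢-t x≢-q)) c≤x

≡ᵇ-≢ : ∀ {k n} → k ≢ n → (k ≡ᵇ n) ≡ false
≡ᵇ-≢ {k} {n} k≢n with k ≡ᵇ n in eq
... | false = refl
... | true  = ⊥-elim (k≢n (ℕₚ.≡ᵇ⇒≡ k n (Equivalence.from T-≡ eq)))

≡ᵇ-refl : ∀ k → (k ≡ᵇ k) ≡ true
≡ᵇ-refl k = Equivalence.to T-≡ (ℕₚ.≡⇒≡ᵇ k k refl)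

gen-below : ∀ {n k} x → k ≢ n → gen n k x ≡ exchange (+ k) (+ suc k) x
gen-below x k≢n rewrite ≡ᵇ-≢ k≢n = refl

module Generators (N : ℕ) where

  n : ℕ
  n = suc (suc N)

  private
    module E = Exchange {+ suc N} { -[1+ suc N ]} (λ ()) (λ ()) (λ ())

  sLast≗exchange : ∀ x → sLast n x ≡ exchange (+ suc N) -[1+ suc N ] x
  sLast≗exchange x with E.view x
  ... | E.is-t refl     rewrite E.σ-t = refl
  ... | E.is-q refl     rewrite E.σ-q | ≡ᵇ-≢ (ℕₚ.1+n≢n {N}) | ≡ᵇ-refl N = refl
  ... | E.is-neg-t refl rewrite E.σ-neg-t | ≡ᵇ-refl N = refl
  ... | E.is-neg-q refl rewrite E.σ-neg-q = refl
  ... | E.other a b c d rewrite E.σ-other a b c d | ==-≢ a | ==-≢ d | ==-≢ c | ==-≢ b = refl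

  gen-top : ∀ x → gen n n x ≡ exchange (+ suc N) -[1+ suc N ] x
  gen-top x rewrite ≡ᵇ-refl N = sLast≗exchange x

  gen-top-low : gen n n (+ suc N) ≡ - + n
  gen-top-low = trans (gen-top _) E.σ-t

  gen-top-high : gen n n (+ n) ≡ - + suc N
  gen-top-high = trans (gen-top _) E.σ-neg-q

  gen-top-fix : ∀ k → k ≢ suc N → k ≢ n → gen n n (+ k) ≡ + k
  gen-top-fix k k≢N k≢n = trans (gen-top _) (E.σ-other (k≢N ∘ +-injective) (λ ()) (λ ()) (k≢n ∘ +-injective))

  gen-FixesBelow : ∀ c k → 1 ≤ c → c ≤ suc N → c ≤ k → k ≤ n → FixesBelow c (gen n k)
  gen-FixesBelow c k 1≤c c≤N c≤k k≤n with k ℕ.≟ n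
  ... | yes refl = FixesBelow-≗ (sym ∘ gen-top)
                     (exchange-FixesBelow c (λ ()) (λ ()) (λ ()) c≤N (ℕₚ.m≤n⇒m≤1+n c≤N))
  ... | no  k≢n  = FixesBelow-≗ (λ x → sym (gen-below x k≢n))
                     (exchange-FixesBelow c k≢0 (λ ()) (ℕₚ.1+n≢n ∘ +-injective) c≤k (ℕₚ.m≤n⇒m≤1+n c≤k))
    where
      k≢0 : + k ≢ + 0
      k≢0 refl = ℕₚ.<⇒≱ (ℕₚ.<-≤-trans 1≤c c≤k) z≤n

  word-FixesBelow : ∀ c ws → 1 ≤ c → c ≤ suc N → All (λ k → c ≤ k × k ≤ n) ws → FixesBelow c (word n ws)
  word-FixesBelow c []       _   _   _                 = FixesBelow-id c
  word-FixesBelow c (k ∷ ws) 1≤c c≤N ((c≤k , k≤n) ∷ ks) =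
    FixesBelow-∘ (gen-FixesBelow c k 1≤c c≤N c≤k k≤n) (word-FixesBelow c ws 1≤c c≤N ks)

  gen-involutive : ∀ k x → 1 ≤ k → gen n k (gen n k x) ≡ x
  gen-involutive k x 1≤k with k ℕ.≟ n
  ... | yes refl rewrite gen-top x | gen-top (exchange (+ suc N) -[1+ suc N ] x) =
    Exchange.involutive {+ suc N} { -[1+ suc N ]} (λ ()) (λ ()) (λ ()) x
  ... | no  k≢n  rewrite gen-below x k≢n | gen-below (exchange (+ k) (+ suc k) x) k≢n =
    Exchange.involutive {+ k} {+ suc k} k≢0 (λ ()) (ℕₚ.1+n≢n ∘ +-injective) x
    where
      k≢0 : + k ≢ + 0
      k≢0 refl = ℕₚ.<⇒≱ 1≤k z≤n

  word-++ : ∀ xs ys x → word n (xs ++ ys) x ≡ word n xs (word n ys x)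
  word-++ []       ys x = refl
  word-++ (k ∷ xs) ys x = cong (gen n k) (word-++ xs ys x)

  word-reverse : ∀ ws x → All (1 ≤_) ws → word n (reverse ws) (word n ws x) ≡ x
  word-reverse []       x _          = refl
  word-reverse (k ∷ ws) x (1≤k ∷ ks) = begin
    word n (reverse (k ∷ ws)) (gen n k (word n ws x))
      ≡⟨ cong (λ v → word n v (gen n k (word n ws x))) (unfold-reverse k ws) ⟩
    word n (reverse ws ∷ʳ k) (gen n k (word n ws x))       ≡⟨ word-++ (reverse ws) (k ∷ []) _ ⟩
    word n (reverse ws) (gen n k (gen n k (word n ws x)))  ≡⟨ cong (word n (reverse ws)) (gen-involutive k _ 1≤k) ⟩
    word n (reverse ws) (word n ws x)                      ≡⟨ word-reverse ws x ks ⟩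
    x                                                      ∎

  private
    module Adjacent (k : ℕ) = Exchange {+ suc k} {+ suc (suc k)} (λ ()) (λ ()) (ℕₚ.1+n≢n ∘ +-injective)

  gen-up : ∀ k → suc k < n → gen n (suc k) (+ suc k) ≡ + suc (suc k)
  gen-up k k<n = trans (gen-below _ (ℕₚ.<⇒≢ k<n)) (Adjacent.σ-t k)

  gen-down : ∀ k → suc k < n → gen n (suc k) (+ suc (suc k)) ≡ + suc k
  gen-down k k<n = trans (gen-below _ (ℕₚ.<⇒≢ k<n)) (Adjacent.σ-q k)

  gen-fix : ∀ k m → suc k < n → m ≢ suc k → m ≢ suc (suc k) → gen n (suc k) (+ m) ≡ + m
  gen-fix k m k<n m≢k m≢1+k = trans (gen-below _ (ℕₚ.<⇒≢ k<n))
    (Adjacent.σ-other k (m≢k ∘ +-injective) (m≢1+k ∘ +-injective) (λ ()) (λ ()))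

ascending : ℕ → ℕ → List ℕ
ascending a zero    = []
ascending a (suc l) = a ∷ ascending (suc a) l

module Cycle (N : ℕ) where
  open Generators N

  private
    tail-fits : ∀ a l → a + suc l ≤ n → suc a + l ≤ n
    tail-fits a l = subst (_≤ n) (ℕₚ.+-suc a l)

    head-fits : ∀ a l → a + suc l ≤ n → a < n
    head-fits a l = ℕₚ.<-≤-trans (ℕₚ.m<m+n a (s≤s z≤n))

  cycle-below : ∀ l a k → 1 ≤ a → a + l ≤ n → k < a → word n (ascending a l) (+ k) ≡ + k
  cycle-below zero    a       k _ _    _   = refl
  cycle-below (suc l) (suc a) k _ fits k<a =
    trans (cong (gen n (suc a)) (cycle-below l (suc (suc a)) k (s≤s z≤n) (tail-fits (suc a) l fits) (ℕₚ.m<n⇒m<1+n k<a)))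
          (gen-fix a k (head-fits (suc a) l fits) (ℕₚ.<⇒≢ k<a) (ℕₚ.<⇒≢ (ℕₚ.m<n⇒m<1+n k<a)))

  cycle-above : ∀ l a k → 1 ≤ a → a + l ≤ n → a + l < k → word n (ascending a l) (+ k) ≡ + k
  cycle-above zero    a       k _ _    _     = refl
  cycle-above (suc l) (suc a) k _ fits a+l<k =
    trans (cong (gen n (suc a)) (cycle-above l (suc (suc a)) k (s≤s z≤n) (tail-fits (suc a) l fits)
                                             (subst (_< k) (ℕₚ.+-suc (suc a) l) a+l<k)))
          (gen-fix a k (head-fits (suc a) l fits) (ℕₚ.>⇒≢ a<k) (ℕₚ.>⇒≢ 1+a<k))
    where
      1+a<k : suc (suc a) < k
      1+a<k = ℕₚ.≤-<-trans (ℕₚ.≤-trans (s≤s (ℕₚ.m≤m+n (suc a) l)) (ℕₚ.≤-reflexive (sym (ℕₚ.+-suc (suc a) l)))) a+l<k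
      a<k : suc a < k
      a<k = ℕₚ.<-trans (ℕₚ.n<1+n _) 1+a<k

  cycle-top : ∀ l a → 1 ≤ a → a + l ≤ n → word n (ascending a l) (+ (a + l)) ≡ + a
  cycle-top zero    a       _ _    = cong +_ (ℕₚ.+-identityʳ a)
  cycle-top (suc l) (suc a) _ fits = begin
    gen n (suc a) (word n (ascending (suc (suc a)) l) (+ (suc a + suc l)))
      ≡⟨ cong (λ m → gen n (suc a) (word n (ascending (suc (suc a)) l) (+ m))) (ℕₚ.+-suc (suc a) l) ⟩
    gen n (suc a) (word n (ascending (suc (suc a)) l) (+ (suc (suc a) + l)))
      ≡⟨ cong (gen n (suc a)) (cycle-top l (suc (suc a)) (s≤s z≤n) (tail-fits (suc a) l fits)) ⟩
    gen n (suc a) (+ suc (suc a))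
      ≡⟨ gen-down a (head-fits (suc a) l fits) ⟩
    + suc a ∎

  cycle-shift : ∀ l a k → 1 ≤ a → a + l ≤ n → a ≤ k → k < a + l → word n (ascending a l) (+ k) ≡ + suc k
  cycle-shift zero    a       k _ _    a≤k k<a+0 = ⊥-elim (ℕₚ.<⇒≱ k<a+0 (subst (_≤ k) (sym (ℕₚ.+-identityʳ a)) a≤k))
  cycle-shift (suc l) (suc a) k _ fits a≤k k<a+l with k ℕ.≟ suc a
  ... | yes refl =
    trans (cong (gen n (suc a)) (cycle-below l (suc (suc a)) (suc a) (s≤s z≤n) (tail-fits (suc a) l fits) (ℕₚ.n<1+n _)))
          (gen-up a (head-fits (suc a) l fits))
  ... | no k≢a =
    trans (cong (gen n (suc a)) (cycle-shift l (suc (suc a)) k (s≤s z≤n) (tail-fits (suc a) l fits)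
                                             (ℕₚ.≤∧≢⇒< a≤k (k≢a ∘ sym)) (subst (k <_) (ℕₚ.+-suc (suc a) l) k<a+l)))
          (gen-fix a (suc k) (head-fits (suc a) l fits) (ℕₚ.>⇒≢ (s≤s a≤k)) (k≢a ∘ ℕₚ.suc-injective))

applyUpTo-ascending : ∀ a l → applyUpTo (λ k → a + k) l ≡ ascending a l
applyUpTo-ascending a zero    = refl
applyUpTo-ascending a (suc l) = cong₂ _∷_ (ℕₚ.+-identityʳ a) (begin
  applyUpTo (λ k → a + suc k) l   ≡⟨ applyUpTo-cong l (ℕₚ.+-suc a) ⟩
  applyUpTo (λ k → suc a + k) l   ≡⟨ applyUpTo-ascending (suc a) l ⟩
  ascending (suc a) l             ∎)
  where
    applyUpTo-cong : ∀ l {f g : ℕ → ℕ} → (∀ k → f k ≡ g k) → applyUpTo f l ≡ applyUpTo g l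
    applyUpTo-cong zero    f≗g = refl
    applyUpTo-cong (suc l) f≗g = cong₂ _∷_ (f≗g 0) (applyUpTo-cong l (f≗g ∘ suc))

range-ascending : ∀ a b l → a + l ≡ suc b → range a b ≡ ascending a l
range-ascending a b l a+l≡1+b = begin
  map (λ k → a + k) (upTo (suc b ∸ a))   ≡⟨ map-upTo (λ k → a + k) (suc b ∸ a) ⟩
  applyUpTo (λ k → a + k) (suc b ∸ a)    ≡⟨ applyUpTo-ascending a (suc b ∸ a) ⟩
  ascending a (suc b ∸ a)                ≡⟨ cong (ascending a) (trans (cong (_∸ a) (sym a+l≡1+b)) (ℕₚ.m+n∸m≡n a l)) ⟩
  ascending a l                          ∎

ascending-++ : ∀ a l₁ l₂ → ascending a (l₁ + l₂) ≡ ascending a l₁ ++ ascending (a + l₁) l₂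
ascending-++ a zero     l₂ = cong (λ b → ascending b l₂) (sym (ℕₚ.+-identityʳ a))
ascending-++ a (suc l₁) l₂ = cong (a ∷_) (trans (ascending-++ (suc a) l₁ l₂)
                                                (cong (λ b → ascending (suc a) l₁ ++ ascending b l₂) (sym (ℕₚ.+-suc a l₁))))

ascending-∷ʳ : ∀ a l → ascending a (suc l) ≡ ascending a l ∷ʳ (a + l)
ascending-∷ʳ a l = trans (cong (ascending a) (ℕₚ.+-comm 1 l)) (ascending-++ a l 1)

All-ascending : ∀ a l → All (λ k → a ≤ k × k < a + l) (ascending a l)
All-ascending a zero    = []
All-ascending a (suc l) = (ℕₚ.≤-refl , ℕₚ.m<m+n a (s≤s z≤n))
  ∷ All.map (λ {k} (a<k , k<) → ℕₚ.<⇒≤ a<k , subst (k <_) (sym (ℕₚ.+-suc a l)) k<) (All-ascending (suc a) l)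

All-range : ∀ a b → All (λ k → a ≤ k × k ≤ b) (range a b)
All-range a b with a ℕ.≤? suc b
... | yes a≤1+b = subst (All _) (sym (range-ascending a b (suc b ∸ a) (ℕₚ.m+[n∸m]≡n a≤1+b)))
  (All.map (λ {k} (a≤k , k<) → a≤k , ℕₚ.≤-pred (subst (k <_) (ℕₚ.m+[n∸m]≡n a≤1+b) k<)) (All-ascending a (suc b ∸ a)))
... | no a≰1+b rewrite ℕₚ.m≤n⇒m∸n≡0 (ℕₚ.<⇒≤ (ℕₚ.≰⇒> a≰1+b)) = []

interval : ℕ → ℕ → List ℤ
interval a b = map (λ k → + k) (range a b)

pos : ℕ → ℕ → List ℤ
pos a l = map (λ k → + k) (ascending a l)

interval-pos : ∀ a b l → a + l ≡ suc b → interval a b ≡ pos a l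
interval-pos a b l eq = cong (map (λ k → + k)) (range-ascending a b l eq)

pos-++ : ∀ a l₁ l₂ → pos a (l₁ + l₂) ≡ pos a l₁ ++ pos (a + l₁) l₂
pos-++ a l₁ l₂ = trans (cong (map (λ k → + k)) (ascending-++ a l₁ l₂)) (map-++ (λ k → + k) (ascending a l₁) _)

pos-∷ʳ : ∀ a l → pos a (suc l) ≡ pos a l ∷ʳ + (a + l)
pos-∷ʳ a l = trans (cong (map (λ k → + k)) (ascending-∷ʳ a l)) (map-++ (λ k → + k) (ascending a l) _)

All-pos : ∀ {P : ℤ → Set} a l → (∀ k → a ≤ k → k < a + l → P (+ k)) → All P (pos a l)
All-pos a l Pk = All.map⁺ (All.map (λ {k} (a≤k , k<) → Pk k a≤k k<) (All-ascending a l))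

All-neg-pos : ∀ {P : ℤ → Set} a l → (∀ k → a ≤ k → k < a + l → P (- + k)) → All P (reverse (map -_ (pos a l)))
All-neg-pos a l Pk = All-reverse (All.map⁺ (All-pos a l Pk))

map-pos-shift : ∀ {f : ℤ → ℤ} a l → (∀ k → a ≤ k → k < a + l → f (+ k) ≡ + suc k) → map f (pos a l) ≡ pos (suc a) l
map-pos-shift a zero    fk = refl
map-pos-shift a (suc l) fk = cong₂ _∷_ (fk a ℕₚ.≤-refl (ℕₚ.m<m+n a (s≤s z≤n)))
  (map-pos-shift (suc a) l λ k a<k k< → fk k (ℕₚ.<⇒≤ a<k) (subst (k <_) (sym (ℕₚ.+-suc a l)) k<))

map-pos-fixed : ∀ {f : ℤ → ℤ} a l → (∀ k → a ≤ k → k < a + l → f (+ k) ≡ + k) → map f (pos a l) ≡ pos a l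
map-pos-fixed a zero    fk = refl
map-pos-fixed a (suc l) fk = cong₂ _∷_ (fk a ℕₚ.≤-refl (ℕₚ.m<m+n a (s≤s z≤n)))
  (map-pos-fixed (suc a) l λ k a<k k< → fk k (ℕₚ.<⇒≤ a<k) (subst (k <_) (sym (ℕₚ.+-suc a l)) k<))

filterᵇ-pos : ∀ c a l → c ≤ a → filterᵇ (atLeast c) (pos a l) ≡ pos a l
filterᵇ-pos c a l c≤a = filterᵇ-all (All-pos a l λ k a≤k _ → atLeast-true (+ k) (ℕₚ.≤-trans c≤a a≤k))

pos-≢ : ∀ i a l → i < a → All (_≢ + i) (pos a l)
pos-≢ i a l i<a = All-pos a l λ k a≤k _ k≡i → ℕₚ.<⇒≢ (ℕₚ.<-≤-trans i<a a≤k) (sym (+-injective k≡i))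

window-until : ∀ {i} P Z → All (_≢ + i) P → window i (P ++ + i ∷ Z) ≡ filterᵇ (atLeast (suc i)) P
window-until {i} P Z P≢i = trans (window-++ P (+ i ∷ Z) P≢i)
  (trans (cong (filterᵇ (atLeast (suc i)) P ++_) (window-stop {i} Z refl)) (++-identityʳ _))

small-self : ∀ m → atLeast (suc m) (+ m) ≡ false
small-self m = atLeast-false (+ m) (ℕₚ.n<1+n m)

small-neg-self : ∀ m → atLeast (suc m) (- + m) ≡ false
small-neg-self m = trans (atLeast-even (suc m) (+ m)) (small-self m)

-- The action of 𝒲_m on m, …, n

-- The modules below are parametrised so that n and j are sums (n = m + d + e + 1 and j = m + d,
-- or n = m + L + 1); this keeps truncated subtraction out of the ranges.

module Image-up (m' d e : ℕ) where
  N : ℕ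
  N = m' + d + e
  open Generators N using (n)
  open Cycle N
  m : ℕ
  m = suc m'
  j : ℕ
  j = m + d

  A B : List ℤ
  A = pos (suc m) (suc d)
  B = pos (suc (m + suc d)) e

  private
    U : ℤ → ℤ
    U = word n (ascending m (suc d))

    fits : m + suc d ≤ n
    fits = subst (_≤ n) (sym (lemma m' d)) (s≤s (s≤s (ℕₚ.m≤m+n (m' + d) e)))
      where lemma : ∀ m' d → suc m' + suc d ≡ suc (suc (m' + d))
            lemma = solve-∀

  image : map (word n (range m j)) (interval m n) ≡ A ++ + m ∷ B
  image = begin
    map (word n (range m j)) (interval m n)
      ≡⟨ cong₂ (λ r s → map (word n r) s) (range-ascending m j (suc d) (ℕₚ.+-suc m d))
                                          (interval-pos m n (suc d + suc e) (lemma m' d e)) ⟩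
    map U (pos m (suc d + suc e))
      ≡⟨ cong (map U) (pos-++ m (suc d) (suc e)) ⟩
    map U (pos m (suc d) ++ + (m + suc d) ∷ pos (suc (m + suc d)) e)
      ≡⟨ map-++ U (pos m (suc d)) _ ⟩
    map U (pos m (suc d)) ++ U (+ (m + suc d)) ∷ map U (pos (suc (m + suc d)) e)
      ≡⟨ cong₂ _++_ (map-pos-shift m (suc d) λ k m≤k k< → cycle-shift (suc d) m k (s≤s z≤n) fits m≤k k<)
                    (cong₂ _∷_ (cycle-top (suc d) m (s≤s z≤n) fits)
                               (map-pos-fixed _ e λ k m+d<k _ → cycle-above (suc d) m k (s≤s z≤n) fits m+d<k)) ⟩
    A ++ + m ∷ B ∎
    where
      lemma : ∀ m' d e → suc m' + (suc d + suc e) ≡ suc (suc (suc (m' + d + e)))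
      lemma = solve-∀

  level : filterᵇ (atLeast (suc m)) (map (word n (range m j)) (interval m n)) ≈± interval (suc m) n
  level = inj₁ (sym (begin
    filterᵇ (atLeast (suc m)) (map (word n (range m j)) (interval m n))
      ≡⟨ cong (filterᵇ (atLeast (suc m))) image ⟩
    filterᵇ (atLeast (suc m)) (A ++ + m ∷ B)
      ≡⟨ filter-++ (T? ∘ atLeast (suc m)) A (+ m ∷ B) ⟩
    filterᵇ (atLeast (suc m)) A ++ filterᵇ (atLeast (suc m)) (+ m ∷ B)
      ≡⟨ cong₂ _++_ (filterᵇ-pos (suc m) (suc m) (suc d) ℕₚ.≤-refl)
                    (trans (filterᵇ-reject (atLeast (suc m)) {+ m} B (small-self m))
                           (filterᵇ-pos (suc m) _ e (s≤s (ℕₚ.m≤m+n m (suc d))))) ⟩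
    A ++ B
      ≡⟨ pos-++ (suc m) (suc d) e ⟨
    pos (suc m) (suc d + e)
      ≡⟨ interval-pos (suc m) n (suc d + e) (lemma m' d e) ⟨
    interval (suc m) n ∎))
    where
      lemma : ∀ m' d e → suc (suc m') + (suc d + e) ≡ suc (suc (suc (m' + d + e)))
      lemma = solve-∀

  window-image : window m (unfold (map (word n (range m j)) (interval m n))) ≡ interval (suc m) (suc j)
  window-image = begin
    window m (unfold (map (word n (range m j)) (interval m n)))   ≡⟨ cong (window m ∘ unfold) image ⟩
    window m ((A ++ + m ∷ B) ++ _)                                 ≡⟨ cong (window m) (++-assoc A (+ m ∷ B) _) ⟩
    window m (A ++ + m ∷ (B ++ _))                                 ≡⟨ window-until A _ (pos-≢ m (suc m) (suc d) ℕₚ.≤-refl) ⟩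
    filterᵇ (atLeast (suc m)) A                                    ≡⟨ filterᵇ-pos (suc m) (suc m) (suc d) ℕₚ.≤-refl ⟩
    A                                                              ≡⟨ interval-pos (suc m) (suc j) (suc d) (cong suc (ℕₚ.+-suc m d)) ⟨
    interval (suc m) (suc j)                                       ∎

module Image-id (m' L : ℕ) where
  N : ℕ
  N = m' + L
  open Generators N using (n)
  m : ℕ
  m = suc m'

  private
    split : interval m n ≡ + m ∷ pos (suc m) (suc L)
    split = interval-pos m n (suc (suc L)) (lemma m' L)
      where lemma : ∀ m' L → suc m' + suc (suc L) ≡ suc (suc (suc (m' + L)))
            lemma = solve-∀

  level : filterᵇ (atLeast (suc m)) (map id (interval m n)) ≈± interval (suc m) n
  level = inj₁ (sym (begin
    filterᵇ (atLeast (suc m)) (map id (interval m n))      ≡⟨ cong (filterᵇ (atLeast (suc m))) (trans (map-id _) split) ⟩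
    filterᵇ (atLeast (suc m)) (+ m ∷ pos (suc m) (suc L))  ≡⟨ filterᵇ-reject (atLeast (suc m)) {+ m} _ (small-self m) ⟩
    filterᵇ (atLeast (suc m)) (pos (suc m) (suc L))        ≡⟨ filterᵇ-pos (suc m) (suc m) (suc L) ℕₚ.≤-refl ⟩
    pos (suc m) (suc L)                                    ≡⟨ interval-pos (suc m) n (suc L) (lemma m' L) ⟨
    interval (suc m) n                                     ∎))
    where
      lemma : ∀ m' L → suc (suc m') + suc L ≡ suc (suc (suc (m' + L)))
      lemma = solve-∀

  window-image : window m (unfold (map id (interval m n))) ≡ []
  window-image = trans (cong (window m ∘ unfold) (trans (map-id _) split)) (window-stop {m} _ refl)

module Image-tip (m' L : ℕ) where
  N : ℕ
  N = m' + L
  open Generators N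
  open Cycle N
  m : ℕ
  m = suc m'

  A : List ℤ
  A = pos (suc m) L

  private
    U : ℤ → ℤ
    U = word n (ascending m L)
    Q : ℤ → ℤ
    Q = word n (range m N ++ n ∷ [])

    fits : m + L ≤ n
    fits = ℕₚ.n≤1+n _

    Q≗U∘gen : ∀ x → Q x ≡ U (gen n n x)
    Q≗U∘gen x = trans (word-++ (range m N) (n ∷ []) x) (cong (λ r → word n r (gen n n x)) (range-ascending m N L refl))

    U-odd : ∀ x → U (- x) ≡ - U x
    U-odd = FixesBelow.odd (word-FixesBelow 1 (ascending m L) (s≤s z≤n) (s≤s z≤n)
      (All.map (λ {k} (m≤k , k<) → ℕₚ.≤-trans (s≤s z≤n) m≤k , ℕₚ.≤-trans (ℕₚ.<⇒≤ k<) fits) (All-ascending m L)))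

  image : map Q (interval m n) ≡ A ++ - + n ∷ - + m ∷ []
  image = begin
    map Q (interval m n)
      ≡⟨ cong (map Q) (trans (interval-pos m n (L + 2) (lemma m' L)) (pos-++ m L 2)) ⟩
    map Q (pos m L ++ + suc N ∷ + n ∷ [])
      ≡⟨ map-++ Q (pos m L) _ ⟩
    map Q (pos m L) ++ Q (+ suc N) ∷ Q (+ n) ∷ []
      ≡⟨ cong₂ _++_ (map-pos-shift m L λ k m≤k k<m+L → trans (Q≗U∘gen (+ k))
                       (trans (cong U (gen-top-fix k (ℕₚ.<⇒≢ k<m+L) (ℕₚ.<⇒≢ (ℕₚ.m<n⇒m<1+n k<m+L))))
                              (cycle-shift L m k (s≤s z≤n) fits m≤k k<m+L)))
                    (cong₂ _∷_ (trans (Q≗U∘gen _) (trans (cong U gen-top-low) (trans (U-odd (+ n))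
                                  (cong -_ (cycle-above L m n (s≤s z≤n) fits ℕₚ.≤-refl)))))
                               (cong (_∷ []) (trans (Q≗U∘gen _) (trans (cong U gen-top-high) (trans (U-odd (+ suc N))
                                  (cong -_ (cycle-top L m (s≤s z≤n) fits))))))) ⟩
    A ++ - + n ∷ - + m ∷ [] ∎
    where
      lemma : ∀ m' L → suc m' + (L + 2) ≡ suc (suc (suc (m' + L)))
      lemma = solve-∀

  private
    A≢m : All (_≢ + m) A
    A≢m = pos-≢ m (suc m) L ℕₚ.≤-refl

    large-n : atLeast (suc m) (- + n) ≡ true
    large-n = atLeast-true (- + n) (s≤s (s≤s (ℕₚ.m≤m+n m' L)))

  level : filterᵇ (atLeast (suc m)) (map Q (interval m n)) ≈± interval (suc m) n
  level = inj₂ (negLast-flip (begin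
    filterᵇ (atLeast (suc m)) (map Q (interval m n))
      ≡⟨ cong (filterᵇ (atLeast (suc m))) image ⟩
    filterᵇ (atLeast (suc m)) (A ++ - + n ∷ - + m ∷ [])
      ≡⟨ filter-++ (T? ∘ atLeast (suc m)) A _ ⟩
    filterᵇ (atLeast (suc m)) A ++ filterᵇ (atLeast (suc m)) (- + n ∷ - + m ∷ [])
      ≡⟨ cong₂ _++_ (filterᵇ-pos (suc m) (suc m) L ℕₚ.≤-refl)
           (trans (filterᵇ-accept (atLeast (suc m)) { - + n} _ large-n)
                  (cong (- + n ∷_) (filterᵇ-reject (atLeast (suc m)) { - + m} [] (small-neg-self m)))) ⟩
    A ∷ʳ - + n
      ≡⟨ negLast-∷ʳ A (+ n) ⟨
    negLast (A ∷ʳ + n)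
      ≡⟨ cong negLast (trans (interval-pos (suc m) n (suc L) (lemma m' L)) (pos-∷ʳ (suc m) L)) ⟨
    negLast (interval (suc m) n) ∎))
    where
      lemma : ∀ m' L → suc (suc m') + suc L ≡ suc (suc (suc (m' + L)))
      lemma = solve-∀

  window-image : window m (unfold (map Q (interval m n))) ≡ interval (suc m) (suc N) ++ - + n ∷ []
  window-image = begin
    window m (unfold (map Q (interval m n)))
      ≡⟨ cong (window m ∘ unfold) (trans image (sym (++-assoc A (- + n ∷ []) (- + m ∷ [])))) ⟩
    window m (unfold ((A ∷ʳ - + n) ∷ʳ - + m))
      ≡⟨ cong (window m) (unfold-∷ʳ (A ∷ʳ - + n) (- + m)) ⟩
    window m ((A ∷ʳ - + n) ++ - + m ∷ + m ∷ _)
      ≡⟨ cong (window m) (sym (++-assoc (A ∷ʳ - + n) (- + m ∷ []) _)) ⟩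
    window m (((A ∷ʳ - + n) ∷ʳ - + m) ++ + m ∷ _)
      ≡⟨ window-until ((A ∷ʳ - + n) ∷ʳ - + m) _ (All.∷ʳ⁺ (All.∷ʳ⁺ A≢m (λ ())) (λ ())) ⟩
    filterᵇ (atLeast (suc m)) ((A ∷ʳ - + n) ∷ʳ - + m)
      ≡⟨ filter-++ (T? ∘ atLeast (suc m)) (A ∷ʳ - + n) (- + m ∷ []) ⟩
    filterᵇ (atLeast (suc m)) (A ∷ʳ - + n) ++ filterᵇ (atLeast (suc m)) (- + m ∷ [])
      ≡⟨ cong₂ _++_ (filter-++ (T? ∘ atLeast (suc m)) A (- + n ∷ []))
                    (filterᵇ-reject (atLeast (suc m)) { - + m} [] (small-neg-self m)) ⟩
    (filterᵇ (atLeast (suc m)) A ++ filterᵇ (atLeast (suc m)) (- + n ∷ [])) ++ []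
      ≡⟨ ++-identityʳ _ ⟩
    filterᵇ (atLeast (suc m)) A ++ filterᵇ (atLeast (suc m)) (- + n ∷ [])
      ≡⟨ cong₂ _++_ (filterᵇ-pos (suc m) (suc m) L ℕₚ.≤-refl) (filterᵇ-accept (atLeast (suc m)) { - + n} [] large-n) ⟩
    A ∷ʳ - + n
      ≡⟨ cong (_∷ʳ - + n) (interval-pos (suc m) (suc N) L refl) ⟨
    interval (suc m) (suc N) ++ - + n ∷ [] ∎

module Image-dn (m' d e : ℕ) where
  N : ℕ
  N = m' + d + e
  open Generators N
  open Cycle N
  m : ℕ
  m = suc m'
  j : ℕ
  j = m + d

  A B : List ℤ
  A = pos (suc m) d
  B = pos (suc j) e

  private
    U : ℤ → ℤ
    U = word n (ascending m (d + e))
    V : ℤ → ℤ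
    V = word n (ascending j (suc e))
    V⁻¹ : ℤ → ℤ
    V⁻¹ = word n (reverse (ascending j (suc e)))
    Q : ℤ → ℤ
    Q = word n (range m N ++ n ∷ reverse (range j (suc N)))

    m+[d+e] : m + (d + e) ≡ suc N
    m+[d+e] = lemma m' d e
      where lemma : ∀ m' d e → suc m' + (d + e) ≡ suc (m' + d + e)
            lemma = solve-∀

    j+1+e : j + suc e ≡ n
    j+1+e = lemma m' d e
      where lemma : ∀ m' d e → suc m' + d + suc e ≡ suc (suc (m' + d + e))
            lemma = solve-∀

    U-fits : m + (d + e) ≤ n
    U-fits = ℕₚ.≤-trans (ℕₚ.≤-reflexive m+[d+e]) (ℕₚ.n≤1+n _)

    V-fits : j + suc e ≤ n
    V-fits = ℕₚ.≤-reflexive j+1+e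

    Q≗U∘gen∘V⁻¹ : ∀ x → Q x ≡ U (gen n n (V⁻¹ x))
    Q≗U∘gen∘V⁻¹ x = trans (word-++ (range m N) (n ∷ reverse (range j (suc N))) x)
      (cong₂ (λ r s → word n r (gen n n (word n (reverse s) x)))
             (range-ascending m N (d + e) m+[d+e]) (range-ascending j (suc N) (suc e) j+1+e))

    U-odd : ∀ x → U (- x) ≡ - U x
    U-odd = FixesBelow.odd (word-FixesBelow 1 (ascending m (d + e)) (s≤s z≤n) (s≤s z≤n)
      (All.map (λ {k} (m≤k , k<) → ℕₚ.≤-trans (s≤s z≤n) m≤k , ℕₚ.≤-trans (ℕₚ.<⇒≤ k<) U-fits) (All-ascending m (d + e))))

    V⁻¹∘V : ∀ x → V⁻¹ (V x) ≡ x
    V⁻¹∘V x = word-reverse (ascending j (suc e)) x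
      (All.map (λ {k} (j≤k , _) → ℕₚ.≤-trans (s≤s z≤n) j≤k) (All-ascending j (suc e)))

    V⁻¹-below : ∀ k → k < j → V⁻¹ (+ k) ≡ + k
    V⁻¹-below k k<j = trans (cong V⁻¹ (sym (cycle-below (suc e) j k (s≤s z≤n) V-fits k<j))) (V⁻¹∘V (+ k))

    V⁻¹-shift : ∀ k → j ≤ k → k < j + suc e → V⁻¹ (+ suc k) ≡ + k
    V⁻¹-shift k j≤k k< = trans (cong V⁻¹ (sym (cycle-shift (suc e) j k (s≤s z≤n) V-fits j≤k k<))) (V⁻¹∘V (+ k))

    V⁻¹-j : V⁻¹ (+ j) ≡ + n
    V⁻¹-j = trans (cong V⁻¹ (sym (cycle-top (suc e) j (s≤s z≤n) V-fits))) (trans (V⁻¹∘V _) (cong +_ j+1+e))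

    Q-low : ∀ k → m ≤ k → k < m + d → Q (+ k) ≡ + suc k
    Q-low k m≤k k<j = begin
      Q (+ k)                ≡⟨ Q≗U∘gen∘V⁻¹ (+ k) ⟩
      U (gen n n (V⁻¹ (+ k))) ≡⟨ cong (U ∘ gen n n) (V⁻¹-below k k<j) ⟩
      U (gen n n (+ k))       ≡⟨ cong U (gen-top-fix k (ℕₚ.<⇒≢ k<1+N) (ℕₚ.<⇒≢ (ℕₚ.m<n⇒m<1+n k<1+N))) ⟩
      U (+ k)                 ≡⟨ cycle-shift (d + e) m k (s≤s z≤n) U-fits m≤k (subst (k <_) (sym m+[d+e]) k<1+N) ⟩
      + suc k                 ∎
      where
        k<1+N : k < suc N
        k<1+N = ℕₚ.<-≤-trans k<j (subst (j ≤_) m+[d+e] (ℕₚ.≤-trans (ℕₚ.m≤m+n j e) (ℕₚ.≤-reflexive (ℕₚ.+-assoc m d e))))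

    Q-j : Q (+ j) ≡ - + m
    Q-j = begin
      Q (+ j)                  ≡⟨ Q≗U∘gen∘V⁻¹ (+ j) ⟩
      U (gen n n (V⁻¹ (+ j)))   ≡⟨ cong (U ∘ gen n n) V⁻¹-j ⟩
      U (gen n n (+ n))         ≡⟨ cong U gen-top-high ⟩
      U (- + suc N)             ≡⟨ U-odd (+ suc N) ⟩
      - U (+ suc N)             ≡⟨ cong (λ k → - U (+ k)) (sym m+[d+e]) ⟩
      - U (+ (m + (d + e)))     ≡⟨ cong -_ (cycle-top (d + e) m (s≤s z≤n) U-fits) ⟩
      - + m                     ∎

    Q-high : ∀ k → suc j ≤ k → k < suc j + e → Q (+ k) ≡ + k
    Q-high (suc k) (s≤s j≤k) (s≤s k<j+e) = begin
      Q (+ suc k)                  ≡⟨ Q≗U∘gen∘V⁻¹ (+ suc k) ⟩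
      U (gen n n (V⁻¹ (+ suc k)))
        ≡⟨ cong (U ∘ gen n n) (V⁻¹-shift k j≤k (subst (k <_) (sym (ℕₚ.+-suc j e)) (ℕₚ.m<n⇒m<1+n k<j+e))) ⟩
      U (gen n n (+ k))             ≡⟨ cong U (gen-top-fix k (ℕₚ.<⇒≢ k<1+N) (ℕₚ.<⇒≢ (ℕₚ.m<n⇒m<1+n k<1+N))) ⟩
      U (+ k)
        ≡⟨ cycle-shift (d + e) m k (s≤s z≤n) U-fits (ℕₚ.≤-trans (ℕₚ.m≤m+n m d) j≤k) (subst (k <_) (sym m+[d+e]) k<1+N) ⟩
      + suc k                       ∎
      where
        k<1+N : k < suc N
        k<1+N = subst (k <_) (trans (ℕₚ.+-assoc m d e) m+[d+e]) k<j+e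

    Q-n : Q (+ n) ≡ - + n
    Q-n = begin
      Q (+ n)                  ≡⟨ Q≗U∘gen∘V⁻¹ (+ n) ⟩
      U (gen n n (V⁻¹ (+ n)))   ≡⟨ cong (U ∘ gen n n) (V⁻¹-shift (suc N) j≤1+N (subst (suc N <_) (sym j+1+e) ℕₚ.≤-refl)) ⟩
      U (gen n n (+ suc N))     ≡⟨ cong U gen-top-low ⟩
      U (- + n)                 ≡⟨ U-odd (+ n) ⟩
      - U (+ n)                 ≡⟨ cong -_ (cycle-above (d + e) m n (s≤s z≤n) U-fits (subst (_< n) (sym m+[d+e]) ℕₚ.≤-refl)) ⟩
      - + n                     ∎
      where
        j≤1+N : j ≤ suc N
        j≤1+N = subst (j ≤_) m+[d+e] (ℕₚ.≤-trans (ℕₚ.m≤m+n j e) (ℕₚ.≤-reflexive (ℕₚ.+-assoc m d e)))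

  image : map Q (interval m n) ≡ A ++ - + m ∷ (B ∷ʳ - + n)
  image = begin
    map Q (interval m n)
      ≡⟨ cong (map Q) (trans (interval-pos m n (d + suc (suc e)) (lemma m' d e)) (pos-++ m d (suc (suc e)))) ⟩
    map Q (pos m d ++ + j ∷ pos (suc j) (suc e))
      ≡⟨ cong (λ P → map Q (pos m d ++ + j ∷ P)) (pos-∷ʳ (suc j) e) ⟩
    map Q (pos m d ++ + j ∷ (B ∷ʳ + n))
      ≡⟨ map-++ Q (pos m d) _ ⟩
    map Q (pos m d) ++ Q (+ j) ∷ map Q (B ∷ʳ + n)
      ≡⟨ cong₂ (λ P R → P ++ Q (+ j) ∷ R) (map-pos-shift m d Q-low) (map-++ Q B (+ n ∷ [])) ⟩
    A ++ Q (+ j) ∷ (map Q B ∷ʳ Q (+ n))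
      ≡⟨ cong₂ (λ x R → A ++ x ∷ R) Q-j (cong₂ _∷ʳ_ (map-pos-fixed (suc j) e Q-high) Q-n) ⟩
    A ++ - + m ∷ (B ∷ʳ - + n) ∎
    where
      lemma : ∀ m' d e → suc m' + (d + suc (suc e)) ≡ suc (suc (suc (m' + d + e)))
      lemma = solve-∀

  private
    interval-split : interval (suc m) n ≡ (A ++ B) ∷ʳ + n
    interval-split = begin
      interval (suc m) n              ≡⟨ interval-pos (suc m) n (d + suc e) (lemma m' d e) ⟩
      pos (suc m) (d + suc e)         ≡⟨ pos-++ (suc m) d (suc e) ⟩
      A ++ pos (suc j) (suc e)        ≡⟨ cong (A ++_) (pos-∷ʳ (suc j) e) ⟩
      A ++ (B ∷ʳ + n)                 ≡⟨ ++-assoc A B _ ⟨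
      (A ++ B) ∷ʳ + n                 ∎
      where
        lemma : ∀ m' d e → suc (suc m') + (d + suc e) ≡ suc (suc (suc (m' + d + e)))
        lemma = solve-∀

    large-n : atLeast (suc m) (- + n) ≡ true
    large-n = atLeast-true (- + n) (s≤s (s≤s (ℕₚ.≤-trans (ℕₚ.m≤m+n m' d) (ℕₚ.m≤m+n (m' + d) e))))

    filter-A : filterᵇ (atLeast (suc m)) A ≡ A
    filter-A = filterᵇ-pos (suc m) (suc m) d ℕₚ.≤-refl

    filter-B : filterᵇ (atLeast (suc m)) B ≡ B
    filter-B = filterᵇ-pos (suc m) (suc j) e (s≤s (ℕₚ.m≤m+n m d))

  level : filterᵇ (atLeast (suc m)) (map Q (interval m n)) ≈± interval (suc m) n
  level = inj₂ (negLast-flip (begin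
    filterᵇ (atLeast (suc m)) (map Q (interval m n))
      ≡⟨ cong (filterᵇ (atLeast (suc m))) image ⟩
    filterᵇ (atLeast (suc m)) (A ++ - + m ∷ (B ∷ʳ - + n))
      ≡⟨ filter-++ (T? ∘ atLeast (suc m)) A _ ⟩
    filterᵇ (atLeast (suc m)) A ++ filterᵇ (atLeast (suc m)) (- + m ∷ (B ∷ʳ - + n))
      ≡⟨ cong₂ _++_ filter-A (filterᵇ-reject (atLeast (suc m)) { - + m} _ (small-neg-self m)) ⟩
    A ++ filterᵇ (atLeast (suc m)) (B ∷ʳ - + n)
      ≡⟨ cong (A ++_) (filter-++ (T? ∘ atLeast (suc m)) B _) ⟩
    A ++ (filterᵇ (atLeast (suc m)) B ++ filterᵇ (atLeast (suc m)) (- + n ∷ []))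
      ≡⟨ cong₂ (λ P R → A ++ (P ++ R)) filter-B (filterᵇ-accept (atLeast (suc m)) { - + n} [] large-n) ⟩
    A ++ (B ∷ʳ - + n)
      ≡⟨ ++-assoc A B _ ⟨
    (A ++ B) ∷ʳ - + n
      ≡⟨ negLast-∷ʳ (A ++ B) (+ n) ⟨
    negLast ((A ++ B) ∷ʳ + n)
      ≡⟨ cong negLast interval-split ⟨
    negLast (interval (suc m) n) ∎))

  private
    RB RA : List ℤ
    RB = reverse (map -_ B)
    RA = reverse (map -_ A)

    unfold-image : unfold (A ++ - + m ∷ (B ∷ʳ - + n)) ≡ ((A ++ - + m ∷ B) ++ - + n ∷ + n ∷ RB) ++ + m ∷ RA
    unfold-image = begin
      unfold (A ++ - + m ∷ (B ∷ʳ - + n))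
        ≡⟨ cong unfold (++-assoc A (- + m ∷ B) (- + n ∷ [])) ⟨
      unfold ((A ++ - + m ∷ B) ∷ʳ - + n)
        ≡⟨ unfold-∷ʳ (A ++ - + m ∷ B) (- + n) ⟩
      (A ++ - + m ∷ B) ++ - + n ∷ + n ∷ reverse (map -_ (A ++ - + m ∷ B))
        ≡⟨ cong (λ R → (A ++ - + m ∷ B) ++ - + n ∷ + n ∷ reverse R) (map-++ -_ A (- + m ∷ B)) ⟩
      (A ++ - + m ∷ B) ++ - + n ∷ + n ∷ reverse (map -_ A ++ + m ∷ map -_ B)
        ≡⟨ cong (λ R → (A ++ - + m ∷ B) ++ - + n ∷ + n ∷ R)
                (trans (reverse-++ (map -_ A) (+ m ∷ map -_ B))
                       (trans (cong (_++ RA) (unfold-reverse (+ m) (map -_ B))) (++-assoc RB (+ m ∷ []) RA))) ⟩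
      (A ++ - + m ∷ B) ++ - + n ∷ + n ∷ (RB ++ + m ∷ RA)
        ≡⟨ ++-assoc (A ++ - + m ∷ B) (- + n ∷ + n ∷ RB) (+ m ∷ RA) ⟨
      ((A ++ - + m ∷ B) ++ - + n ∷ + n ∷ RB) ++ + m ∷ RA ∎

    j<k⇒ : ∀ k → suc j ≤ k → - + k ≢ + m × atLeast (suc m) (- + k) ≡ true
    j<k⇒ (suc k) j<k = (λ ()) , atLeast-true (- + suc k) (ℕₚ.≤-trans (s≤s (s≤s (ℕₚ.m≤m+n m' d))) j<k)

    prefix≢m : All (_≢ + m) ((A ++ - + m ∷ B) ++ - + n ∷ + n ∷ RB)
    prefix≢m = All.++⁺ (All.++⁺ (pos-≢ m (suc m) d ℕₚ.≤-refl) ((λ ()) ∷ pos-≢ m (suc j) e (s≤s (ℕₚ.m≤m+n m d))))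
                       ((λ ()) ∷ n≢m ∷ All-neg-pos (suc j) e (λ k j<k _ → proj₁ (j<k⇒ k j<k)))
      where
        n≢m : + n ≢ + m
        n≢m n≡m = ℕₚ.<⇒≢ (s≤s (s≤s (ℕₚ.≤-trans (ℕₚ.m≤m+n m' d) (ℕₚ.m≤m+n (m' + d) e)))) (sym (+-injective n≡m))

    filter-RB : filterᵇ (atLeast (suc m)) RB ≡ RB
    filter-RB = filterᵇ-all (All-neg-pos (suc j) e (λ k j<k _ → proj₂ (j<k⇒ k j<k)))

    neg-tail : map neg (reverse (range (suc j) n)) ≡ - + n ∷ RB
    neg-tail = begin
      map neg (reverse (range (suc j) n))
        ≡⟨ cong (map neg ∘ reverse) (trans (range-ascending (suc j) n (suc e) (cong suc j+1+e)) (ascending-∷ʳ (suc j) e)) ⟩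
      map neg (reverse (ascending (suc j) e ∷ʳ n))
        ≡⟨ cong (map neg) (reverse-++ (ascending (suc j) e) (n ∷ [])) ⟩
      neg n ∷ map neg (reverse (ascending (suc j) e))
        ≡⟨ cong (neg n ∷_) (trans (reverse-map neg (ascending (suc j) e)) (cong reverse (map-∘ (ascending (suc j) e)))) ⟩
      - + n ∷ RB ∎

  window-image : window m (unfold (map Q (interval m n))) ⇄ interval (suc m) n ++ map neg (reverse (range (suc j) n))
  window-image = ⇄-resp-≡ window≡ listW≡ (⇄-swap (A ++ B) (- + n) RB)
    where
      window≡ : window m (unfold (map Q (interval m n))) ≡ (A ++ B) ++ - + n ∷ + n ∷ RB
      window≡ = begin
        window m (unfold (map Q (interval m n)))
          ≡⟨ cong (window m ∘ unfold) image ⟩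
        window m (unfold (A ++ - + m ∷ (B ∷ʳ - + n)))
          ≡⟨ cong (window m) unfold-image ⟩
        window m (((A ++ - + m ∷ B) ++ - + n ∷ + n ∷ RB) ++ + m ∷ RA)
          ≡⟨ window-until _ RA prefix≢m ⟩
        filterᵇ (atLeast (suc m)) ((A ++ - + m ∷ B) ++ - + n ∷ + n ∷ RB)
          ≡⟨ filter-++ (T? ∘ atLeast (suc m)) (A ++ - + m ∷ B) _ ⟩
        filterᵇ (atLeast (suc m)) (A ++ - + m ∷ B) ++ filterᵇ (atLeast (suc m)) (- + n ∷ + n ∷ RB)
          ≡⟨ cong₂ _++_
               (trans (filter-++ (T? ∘ atLeast (suc m)) A _)
                      (cong₂ _++_ filter-A (trans (filterᵇ-reject (atLeast (suc m)) { - + m} B (small-neg-self m)) filter-B)))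
               (trans (filterᵇ-accept (atLeast (suc m)) { - + n} _ large-n)
                      (cong (- + n ∷_) (trans (filterᵇ-accept (atLeast (suc m)) {+ n} _ large-n) (cong (+ n ∷_) filter-RB)))) ⟩
        (A ++ B) ++ - + n ∷ + n ∷ RB ∎
      listW≡ : interval (suc m) n ++ map neg (reverse (range (suc j) n)) ≡ (A ++ B) ++ + n ∷ - + n ∷ RB
      listW≡ = begin
        interval (suc m) n ++ map neg (reverse (range (suc j) n))
          ≡⟨ cong₂ _++_ interval-split neg-tail ⟩
        ((A ++ B) ∷ʳ + n) ++ - + n ∷ RB
          ≡⟨ ++-assoc (A ++ B) (+ n ∷ []) _ ⟩
        (A ++ B) ++ + n ∷ - + n ∷ RB ∎

module Image-last (N : ℕ) where
  open Generators N

  private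
    split : interval (suc N) n ≡ + suc N ∷ + n ∷ []
    split = interval-pos (suc N) n 2 (lemma N)
      where lemma : ∀ N → suc N + 2 ≡ suc (suc (suc N))
            lemma = solve-∀

    1+N<n : suc N < n
    1+N<n = ℕₚ.≤-refl

    n≢1+N : + n ≢ + suc N
    n≢1+N = ℕₚ.1+n≢n ∘ +-injective

    large : ∀ x → ∣ x ∣ ≡ n → atLeast (suc (suc N)) x ≡ true
    large x |x|≡n = atLeast-true x (ℕₚ.≤-reflexive (sym |x|≡n))

    small : atLeast (suc (suc N)) (- + suc N) ≡ false
    small = small-neg-self (suc N)

    ends : ∀ {a b a' b'} → a ≡ a' → b ≡ b' →
           window (suc N) (unfold (a ∷ b ∷ [])) ≡ window (suc N) (unfold (a' ∷ b' ∷ []))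
    ends refl refl = refl

  window-images : ∀ QL → window (suc N) (unfold (actL n QL (+ suc N) ∷ actL n QL (+ n) ∷ [])) ⇄ listL n QL
  window-images idL  = ⇄-resp-≡ (window-stop {suc N} {+ suc N} (+ n ∷ - + n ∷ - + suc N ∷ []) refl) refl ⇄-refl
  window-images s₁L  = ⇄-resp-≡ (begin
    window (suc N) (unfold (gen n (suc N) (+ suc N) ∷ gen n (suc N) (+ n) ∷ []))
      ≡⟨ ends (gen-up N 1+N<n) (gen-down N 1+N<n) ⟩
    window (suc N) (+ n ∷ + suc N ∷ - + suc N ∷ - + n ∷ [])
      ≡⟨ window-accept {suc N} {+ n} _ n≢1+N (large (+ n) refl) ⟩
    + n ∷ window (suc N) (+ suc N ∷ - + suc N ∷ - + n ∷ [])
      ≡⟨ cong (+ n ∷_) (window-stop {suc N} {+ suc N} _ refl) ⟩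
    + n ∷ [] ∎) refl ⇄-refl
  window-images s₂₁L = ⇄-resp-≡ (begin
    window (suc N) (unfold (gen n n (gen n (suc N) (+ suc N)) ∷ gen n n (gen n (suc N) (+ n)) ∷ []))
      ≡⟨ ends (trans (cong (gen n n) (gen-up N 1+N<n)) gen-top-high) (trans (cong (gen n n) (gen-down N 1+N<n)) gen-top-low) ⟩
    window (suc N) (- + suc N ∷ - + n ∷ + n ∷ + suc N ∷ [])
      ≡⟨ window-skip {suc N} { - + suc N} (- + n ∷ + n ∷ + suc N ∷ []) (λ ()) small ⟩
    window (suc N) (- + n ∷ + n ∷ + suc N ∷ [])
      ≡⟨ window-accept {suc N} { - + n} _ (λ ()) (large (- + n) refl) ⟩
    - + n ∷ window (suc N) (+ n ∷ + suc N ∷ [])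
      ≡⟨ cong (- + n ∷_) (window-accept {suc N} {+ n} _ n≢1+N (large (+ n) refl)) ⟩
    - + n ∷ + n ∷ window (suc N) (+ suc N ∷ [])
      ≡⟨ cong (λ W → - + n ∷ + n ∷ W) (window-stop {suc N} {+ suc N} [] refl) ⟩
    - + n ∷ + n ∷ [] ∎) refl (⇄-swap [] (- + n) [])
  window-images s₂L  = ⇄-resp-≡ (begin
    window (suc N) (unfold (gen n n (+ suc N) ∷ gen n n (+ n) ∷ []))
      ≡⟨ ends gen-top-low gen-top-high ⟩
    window (suc N) (- + n ∷ - + suc N ∷ + suc N ∷ + n ∷ [])
      ≡⟨ window-accept {suc N} { - + n} (- + suc N ∷ + suc N ∷ + n ∷ []) (λ ()) (large (- + n) refl) ⟩
    - + n ∷ window (suc N) (- + suc N ∷ + suc N ∷ + n ∷ [])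
      ≡⟨ cong (- + n ∷_) (window-skip {suc N} { - + suc N} (+ suc N ∷ + n ∷ []) (λ ()) small) ⟩
    - + n ∷ window (suc N) (+ suc N ∷ + n ∷ [])
      ≡⟨ cong (- + n ∷_) (window-stop {suc N} {+ suc N} _ refl) ⟩
    - + n ∷ [] ∎) refl ⇄-refl

  window-last : ∀ QL → window (suc N) (unfold (map (actL n QL) (interval (suc N) n))) ⇄ listL n QL
  window-last QL = ⇄-resp-≡ (cong (λ V → window (suc N) (unfold (map (actL n QL) V))) split) refl (window-images QL)

private
  split-up : ∀ {m' j N} → suc m' ≤ j → j ≤ suc N → ∃[ d ] ∃[ e ] suc m' + d ≡ j × m' + d + e ≡ N
  split-up {m'} m<j j≤1+N with ℕₚ.m≤n⇒∃[o]m+o≡n m<j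
  ... | d , refl with ℕₚ.m≤n⇒∃[o]m+o≡n j≤1+N
  ...   | e , m+d+e≡1+N = d , e , refl , ℕₚ.suc-injective m+d+e≡1+N

  split-id : ∀ {m' N} → suc m' ≤ N → ∃[ L ] m' + L ≡ N
  split-id m<N = ℕₚ.m≤n⇒∃[o]m+o≡n (ℕₚ.<⇒≤ m<N)

𝒲-level : ∀ N m' (q : Wc (suc (suc N)) (suc m')) → suc m' ≤ N →
          filterᵇ (atLeast (suc (suc m'))) (map (actW (suc (suc N)) (suc m') q) (interval (suc m') (suc (suc N))))
            ≈± interval (suc (suc m')) (suc (suc N))
𝒲-level N m' idW         m<N with split-id m<N
... | L , refl = Image-id.level m' L
𝒲-level N m' (upW j m≤j j≤n) _ with split-up m≤j j≤n
... | d , e , refl , refl = Image-up.level m' d e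
𝒲-level N m' (dnW j m≤j j≤n) _ with split-up m≤j j≤n
... | d , e , refl , refl = Image-dn.level m' d e
𝒲-level N m' tipW        m<N with split-id m<N
... | L , refl = Image-tip.level m' L

𝒲-window : ∀ N m' (q : Wc (suc (suc N)) (suc m')) → suc m' ≤ N →
           window (suc m') (unfold (map (actW (suc (suc N)) (suc m') q) (interval (suc m') (suc (suc N)))))
             ⇄ listW (suc (suc N)) (suc m') q
𝒲-window N m' idW         m<N with split-id m<N
... | L , refl = ⇄-resp-≡ (Image-id.window-image m' L) refl ⇄-refl
𝒲-window N m' (upW j m≤j j≤n) _ with split-up m≤j j≤n
... | d , e , refl , refl = ⇄-resp-≡ (Image-up.window-image m' d e) refl ⇄-refl
𝒲-window N m' (dnW j m≤j j≤n) _ with split-up m≤j j≤n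
... | d , e , refl , refl = Image-dn.window-image m' d e
𝒲-window N m' tipW        m<N with split-id m<N
... | L , refl = ⇄-resp-≡ (Image-tip.window-image m' L) refl ⇄-refl

-- The factorisation w = P ∘ Q_i ∘ R

wordW-indices : ∀ N m (q : Wc (suc (suc N)) m) → m ≤ N → All (λ k → m ≤ k × k ≤ suc (suc N)) (wordW (suc (suc N)) m q)
wordW-indices N m idW               _   = []
wordW-indices N m (upW j _ j≤1+N)   _   =
  All.map (λ (m≤k , k≤j) → m≤k , ℕₚ.≤-trans k≤j (ℕₚ.m≤n⇒m≤1+n j≤1+N)) (All-range m j)
wordW-indices N m (dnW j m≤j _)     m≤N = All.++⁺
  (All.map (λ (m≤k , k≤N) → m≤k , ℕₚ.m≤n⇒m≤1+n (ℕₚ.m≤n⇒m≤1+n k≤N)) (All-range m N))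
  ((ℕₚ.m≤n⇒m≤1+n (ℕₚ.m≤n⇒m≤1+n m≤N) , ℕₚ.≤-refl)
    ∷ All-reverse (All.map (λ (j≤k , k≤1+N) → ℕₚ.≤-trans m≤j j≤k , ℕₚ.m≤n⇒m≤1+n k≤1+N) (All-range j (suc N))))
wordW-indices N m tipW              m≤N = All.++⁺
  (All.map (λ (m≤k , k≤N) → m≤k , ℕₚ.m≤n⇒m≤1+n (ℕₚ.m≤n⇒m≤1+n k≤N)) (All-range m N))
  ((ℕₚ.m≤n⇒m≤1+n (ℕₚ.m≤n⇒m≤1+n m≤N) , ℕₚ.≤-refl) ∷ [])

actW-FixesBelow : ∀ N m (q : Wc (suc (suc N)) m) c → 1 ≤ c → c ≤ m → m ≤ N → FixesBelow c (actW (suc (suc N)) m q)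
actW-FixesBelow N m q c 1≤c c≤m m≤N = Generators.word-FixesBelow N c (wordW (suc (suc N)) m q) 1≤c
  (ℕₚ.≤-trans c≤m (ℕₚ.m≤n⇒m≤1+n m≤N))
  (All.map (λ (m≤k , k≤n) → ℕₚ.≤-trans c≤m m≤k , k≤n) (wordW-indices N m q m≤N))

actL-FixesBelow : ∀ N QL c → 1 ≤ c → c ≤ suc N → FixesBelow c (actL (suc (suc N)) QL)
actL-FixesBelow N QL c 1≤c c≤1+N = Generators.word-FixesBelow N c (wordL (suc (suc N)) QL) 1≤c c≤1+N (indices QL)
  where
    indices : ∀ QL → All (λ k → c ≤ k × k ≤ suc (suc N)) (wordL (suc (suc N)) QL)
    indices idL  = []
    indices s₁L  = (c≤1+N , ℕₚ.n≤1+n _) ∷ []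
    indices s₂₁L = (ℕₚ.m≤n⇒m≤1+n c≤1+N , ℕₚ.≤-refl) ∷ (c≤1+N , ℕₚ.n≤1+n _) ∷ []
    indices s₂L  = (ℕₚ.m≤n⇒m≤1+n c≤1+N , ℕₚ.≤-refl) ∷ []

compFrom-FixesBelow : ∀ N (Q : (m : ℕ) → Wc (suc (suc N)) m) m l c → 1 ≤ c → c ≤ m → m + l ≤ suc N →
                      FixesBelow c (compFrom (suc (suc N)) Q m l)
compFrom-FixesBelow N Q m zero    c _   _   _    = FixesBelow-id c
compFrom-FixesBelow N Q m (suc l) c 1≤c c≤m fits =
  FixesBelow-∘ (compFrom-FixesBelow N Q (suc m) l c 1≤c (ℕₚ.m≤n⇒m≤1+n c≤m) fits′)
               (actW-FixesBelow N m (Q m) c 1≤c c≤m (ℕₚ.≤-pred (ℕₚ.≤-trans (ℕₚ.m≤m+n (suc m) l) fits′)))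
  where
    fits′ : suc m + l ≤ suc N
    fits′ = subst (_≤ suc N) (ℕₚ.+-suc m l) fits

compFrom-+ : ∀ n (Q : (m : ℕ) → Wc n m) m a b x → compFrom n Q m (a + b) x ≡ compFrom n Q (m + a) b (compFrom n Q m a x)
compFrom-+ n Q m zero    b x = cong (λ k → compFrom n Q k b x) (sym (ℕₚ.+-identityʳ m))
compFrom-+ n Q m (suc a) b x = trans (compFrom-+ n Q (suc m) a b (actW n m (Q m) x))
  (cong (λ k → compFrom n Q k b (compFrom n Q (suc m) a (actW n m (Q m) x))) (sym (ℕₚ.+-suc m a)))

lower-level : ∀ N (Q : (m : ℕ) → Wc (suc (suc N)) m) l m X → 1 ≤ m → m + l ≤ suc N →
              filterᵇ (atLeast m) X ≈± interval m (suc (suc N)) →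
              filterᵇ (atLeast (m + l)) (map (compFrom (suc (suc N)) Q m l) X) ≈± interval (m + l) (suc (suc N))
lower-level N Q zero    m X _ _ X≈ rewrite ℕₚ.+-identityʳ m | map-id X = X≈
lower-level N Q (suc l) (suc m') X _ fits X≈ =
  subst₂ (λ k Y → filterᵇ (atLeast k) Y ≈± interval k (suc (suc N))) (sym (ℕₚ.+-suc (suc m') l)) (sym (map-∘ X))
    (lower-level N Q l (suc (suc m')) (map Qm X) (s≤s z≤n) (subst (_≤ suc N) (ℕₚ.+-suc (suc m') l) fits) step)
  where
    m : ℕ
    m = suc m'
    Qm : ℤ → ℤ
    Qm = actW (suc (suc N)) m (Q m)
    m≤N : m ≤ N
    m≤N = ℕₚ.≤-pred (ℕₚ.≤-trans (ℕₚ.m≤m+n (suc m) l) (subst (_≤ suc N) (ℕₚ.+-suc m l) fits))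
    Qm-fixes : FixesBelow m Qm
    Qm-fixes = actW-FixesBelow N m (Q m) m (s≤s z≤n) ℕₚ.≤-refl m≤N
    filter-first : filterᵇ (atLeast (suc m)) (map Qm (filterᵇ (atLeast m) X)) ≡ filterᵇ (atLeast (suc m)) (map Qm X)
    filter-first = begin
      filterᵇ (atLeast (suc m)) (map Qm (filterᵇ (atLeast m) X))
        ≡⟨ cong (filterᵇ (atLeast (suc m))) (filterᵇ-map (atLeast-invariant Qm-fixes) X) ⟨
      filterᵇ (atLeast (suc m)) (filterᵇ (atLeast m) (map Qm X))
        ≡⟨ filterᵇ-absorb (λ x big → atLeast-true x (ℕₚ.≤-trans (ℕₚ.n≤1+n m) (atLeast-true⁻¹ x big))) (map Qm X) ⟩
      filterᵇ (atLeast (suc m)) (map Qm X) ∎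
    step : filterᵇ (atLeast (suc m)) (map Qm X) ≈± interval (suc m) (suc (suc N))
    step = ≈±-trans
      (subst (_≈± filterᵇ (atLeast (suc m)) (map Qm (interval m (suc (suc N))))) filter-first
        (filterᵇ-≈± (atLeast-even (suc m)) (map-≈± (FixesBelow.odd Qm-fixes) X≈)))
      (𝒲-level N m' (Q m) m≤N)

prodFrom-FixesBelow : ∀ N (Q : (m : ℕ) → Wc (suc (suc N)) m) QL k → 1 ≤ k → k ≤ suc N →
                      FixesBelow k (prodFrom (suc (suc N)) Q QL k)
prodFrom-FixesBelow N Q QL k 1≤k k≤1+N =
  FixesBelow-∘ (actL-FixesBelow N QL k 1≤k k≤1+N)
               (compFrom-FixesBelow N Q k (suc N ∸ k) k 1≤k ℕₚ.≤-refl (ℕₚ.≤-reflexive (ℕₚ.m+[n∸m]≡n k≤1+N)))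

prodFrom-split : ∀ N (Q : (m : ℕ) → Wc (suc (suc N)) m) QL {i} → i < N → ∀ x →
                 prodFrom (suc (suc N)) Q QL 1 x
                   ≡ prodFrom (suc (suc N)) Q QL (suc (suc i))
                       (actW (suc (suc N)) (suc i) (Q (suc i)) (compFrom (suc (suc N)) Q 1 i x))
prodFrom-split N Q QL {i} i<N x = cong (actL n QL) (begin
  compFrom n Q 1 N x
    ≡⟨ cong (λ l → compFrom n Q 1 l x) (ℕₚ.m+[n∸m]≡n (ℕₚ.<⇒≤ i<N)) ⟨
  compFrom n Q 1 (i + (N ∸ i)) x
    ≡⟨ compFrom-+ n Q 1 i (N ∸ i) x ⟩
  compFrom n Q (suc i) (N ∸ i) (compFrom n Q 1 i x)
    ≡⟨ cong (λ l → compFrom n Q (suc i) l (compFrom n Q 1 i x)) (ℕₚ.+-∸-assoc 1 i<N) ⟩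
  compFrom n Q (suc i) (suc (N ∸ suc i)) (compFrom n Q 1 i x) ∎)
  where n = suc (suc N)

lower-factors : ∀ N (Q : (m : ℕ) → Wc (suc (suc N)) m) i → i ≤ N →
                filterᵇ (atLeast (suc i)) (map (compFrom (suc (suc N)) Q 1 i) (posList (suc (suc N))))
                  ≈± interval (suc i) (suc (suc N))
lower-factors N Q i i≤N = lower-level N Q i 1 (posList (suc (suc N))) ℕₚ.≤-refl (s≤s i≤N)
  (inj₁ (sym (filterᵇ-all {atLeast 1} (All.map⁺ (All.map (λ {k} (1≤k , _) → atLeast-true (+ k) 1≤k) (All-range 1 _))))))

nwarrow-factor : ∀ n i (P Q R w : ℤ → ℤ) L →
  (∀ x → w x ≡ P (Q (R x))) → FixesBelow (suc (suc i)) P → FixesBelow (suc i) Q →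
  filterᵇ (atLeast (suc i)) (map R (posList n)) ≈± interval (suc i) n →
  window (suc i) (unfold (map Q (interval (suc i) n))) ⇄ L →
  Sim n (suc i) (map P L) (nwarrow n w (suc i))
nwarrow-factor n i P Q R w L w≗PQR P-fixes Q-fixes R≈ Q⇄L u = begin
  h n (+ I) (map P L) u
    ≡⟨ ⇄⇒Sim (map-⇄ (FixesBelow.odd P-fixes) Q⇄L) u ⟨
  h n (+ I) (map P (window I (unfold (map Q (interval I n))))) u
    ≡⟨ cong (λ L → h n (+ I) L u) pull-P ⟨
  h n (+ I) (window I (unfold (map (P ∘ Q) (interval I n)))) u
    ≡⟨ ⇄⇒Sim (window-⇄ (unfold-≈± (map-≈± (FixesBelow.odd PQ-fixes) R≈))) u ⟨
  h n (+ I) (window I (unfold (map (P ∘ Q) W))) u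
    ≡⟨ cong (λ L → h n (+ I) L u) push-R ⟨
  h n (+ I) (nwarrow n w I) u ∎
  where
    I : ℕ
    I = suc i
    W : List ℤ
    W = filterᵇ (atLeast I) (map R (posList n))
    PQ-fixes : FixesBelow I (P ∘ Q)
    PQ-fixes = FixesBelow-∘ (FixesBelow-weaken (ℕₚ.n≤1+n I) P-fixes) Q-fixes

    push-R : nwarrow n w I ≡ window I (unfold (map (P ∘ Q) W))
    push-R = begin
      nwarrow n w I
        ≡⟨ nwarrow≡window n w i ⟩
      window I (unfold (map w (posList n)))
        ≡⟨ window-below (unfold (map w (posList n))) ⟩
      window I (filterᵇ (atLeast I) (unfold (map w (posList n))))
        ≡⟨ cong (window I) (filterᵇ-unfold (atLeast-even I) (map w (posList n))) ⟩
      window I (unfold (filterᵇ (atLeast I) (map w (posList n))))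
        ≡⟨ cong (window I ∘ unfold ∘ filterᵇ (atLeast I)) (trans (map-cong w≗PQR (posList n)) (map-∘ (posList n))) ⟩
      window I (unfold (filterᵇ (atLeast I) (map (P ∘ Q) (map R (posList n)))))
        ≡⟨ cong (window I ∘ unfold) (filterᵇ-map (atLeast-invariant PQ-fixes) (map R (posList n))) ⟩
      window I (unfold (map (P ∘ Q) W)) ∎

    pull-P : window I (unfold (map (P ∘ Q) (interval I n))) ≡ map P (window I (unfold (map Q (interval I n))))
    pull-P = begin
      window I (unfold (map (P ∘ Q) (interval I n)))
        ≡⟨ cong (window I ∘ unfold) (map-∘ (interval I n)) ⟩
      window I (unfold (map P (map Q (interval I n))))
        ≡⟨ cong (window I) (map-unfold (FixesBelow.odd P-fixes) (map Q (interval I n))) ⟨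
      window I (map P (unfold (map Q (interval I n))))
        ≡⟨ window-map P-fixes (unfold (map Q (interval I n))) ⟩
      map P (window I (unfold (map Q (interval I n)))) ∎

mainTheorem3 : (n : ℕ) → 2 ≤ n → (Q : (m : ℕ) → Wc n m) → (QL : WLast) →
  ((i : ℕ) → 1 ≤ i → i ≤ n ∸ 2 →
     Sim n i (map (prodFrom n Q QL (suc i)) (listW n i (Q i)))
             (nwarrow n (prodFrom n Q QL 1) i))
  × Sim n (n ∸ 1) (listL n QL) (nwarrow n (prodFrom n Q QL 1) (n ∸ 1))
mainTheorem3 (suc (suc N)) (s≤s (s≤s z≤n)) Q QL = middle , final
  where
    n : ℕ
    n = suc (suc N)

    middle : (i : ℕ) → 1 ≤ i → i ≤ N →
             Sim n i (map (prodFrom n Q QL (suc i)) (listW n i (Q i))) (nwarrow n (prodFrom n Q QL 1) i)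
    middle (suc i) _ i<N =
      nwarrow-factor n i (prodFrom n Q QL (suc (suc i))) (actW n (suc i) (Q (suc i))) (compFrom n Q 1 i) _ _
        (prodFrom-split N Q QL i<N) (prodFrom-FixesBelow N Q QL (suc (suc i)) (s≤s z≤n) (s≤s i<N))
        (actW-FixesBelow N (suc i) (Q (suc i)) (suc i) (s≤s z≤n) ℕₚ.≤-refl i<N)
        (lower-factors N Q i (ℕₚ.<⇒≤ i<N)) (𝒲-window N i (Q (suc i)) i<N)

    final : Sim n (suc N) (listL n QL) (nwarrow n (prodFrom n Q QL 1) (suc N))
    final u = trans (cong (λ L → h n (+ suc N) L u) (sym (map-id (listL n QL))))
      (nwarrow-factor n N id (actL n QL) (compFrom n Q 1 N) _ (listL n QL) (λ _ → refl)
        (FixesBelow-id _) (actL-FixesBelow N QL (suc N) (s≤s z≤n) ℕₚ.≤-refl)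
        (lower-factors N Q N ℕₚ.≤-refl) (Image-last.window-last N QL) u)
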